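{- If a sequent $\Gamma\vdash\Delta$ is derivable in $LS_{BBI}$, then it is derivable in $LS_{BBI}$ without using the cut rule.
   Context: BBI formulae: $A ::= p \mid \top \mid \bot \mid \neg A \mid A\lor A \mid A\land A \mid A\to A \mid \top^* \mid A * A \mid A \mathrel{ -\!*} A$, $p$ atomic; $\neg A$ abbreviates $A\to\bot$ and $A\lor B$ abbreviates $\neg(\neg A\land\neg B)$. Labels are label variables (from an infinite set $LVar$) or the constant $\epsilon$. A labelled formula is $w:A$; a relational atom is $(x,y\triangleright z)$ for labels $x,y,z$. A sequent $\Gamma\vdash\Delta$ has $\Gamma$ a finite multiset of labelled formulae and relational atoms and $\Delta$ a finite multiset of labelled formulae; ";" is multiset union. $\Gamma[y/x]$ replaces every occurrence of label $x$ by $y$. Rules of $LS_{BBI}$ ("from premises infer conclusion"; $P$ atomic): id: infer $\Gamma;w:P\vdash w:P;\Delta$. $\bot L$: infer $\Gamma;w:\bot\vdash\Delta$. $\top R$: infer $\Gamma\vdash w:\top;\Delta$. $\top^*R$: infer $\Gamma\vdash\epsilon:\top^*;\Delta$. cut: from $\Gamma\vdash x:A;\Delta$ and $\Gamma';x:A\vdash\Delta'$ infer $\Gamma;\Gamma'\vdash\Delta;\Delta'$. $\top^*L$: from $\Gamma[\epsilon/w]\vdash\Delta[\epsilon/w]$ infer $\Gamma;w:\top^*\vdash\Delta$ ($w\neq\epsilon$). $\land L$: from $\Gamma;w:A;w:B\vdash\Delta$ infer $\Gamma;w:A\land B\vdash\Delta$. $\land R$: from $\Gamma\vdash w:A;\Delta$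 and $\Gamma\vdash w:B;\Delta$ infer $\Gamma\vdash w:A\land B;\Delta$. $\to L$: from $\Gamma\vdash w:A;\Delta$ and $\Gamma;w:B\vdash\Delta$ infer $\Gamma;w:A\to B\vdash\Delta$. $\to R$: from $\Gamma;w:A\vdash w:B;\Delta$ infer $\Gamma\vdash w:A\to B;\Delta$. $*L$: from $(x,y\triangleright z);\Gamma;x:A;y:B\vdash\Delta$ infer $\Gamma;z:A*B\vdash\Delta$ ($x,y$ not in the conclusion). $\mathrel{ -\!*}R$: from $(x,y\triangleright z);\Gamma;x:A\vdash z:B;\Delta$ infer $\Gamma\vdash y:A\mathrel{ -\!*}B;\Delta$ ($x,z$ not in the conclusion). $*R$: from $(x,y\triangleright z);\Gamma\vdash x:A;z:A*B;\Delta$ and $(x,y\triangleright z);\Gamma\vdash y:B;z:A*B;\Delta$ infer $(x,y\triangleright z);\Gamma\vdash z:A*B;\Delta$. $\mathrel{ -\!*}L$: from $(x,y\triangleright z);\Gamma;y:A\mathrel{ -\!*}B\vdash x:A;\Delta$ and $(x,y\triangleright z);\Gamma;y:A\mathrel{ -\!*}B;z:B\vdash\Delta$ infer $(x,y\triangleright z);\Gamma;y:A\mathrel{ -\!*}B\vdash\Delta$. E: from $(y,x\triangleright z);(x,y\triangleright z);\Gamma\vdash\Delta$ infer $(x,y\triangleright z);\Gamma\vdash\Delta$. U: from $(x,\epsilon\triangleright x);\Gamma\vdash\Delta$ infer $\Gamma\vdash\Delta$. A: from $(u,w\triangleright z);(y,v\triangleright w);(x,y\triangleright z);(u,v\triangleright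 x);\Gamma\vdash\Delta$ infer $(x,y\triangleright z);(u,v\triangleright x);\Gamma\vdash\Delta$ ($w$ not in the conclusion). $A_C$: from $(x,w\triangleright x);(y,y\triangleright w);(x,y\triangleright x);\Gamma\vdash\Delta$ infer $(x,y\triangleright x);\Gamma\vdash\Delta$ ($w$ not in the conclusion). $Eq_1$: from $(\epsilon,w'\triangleright w');\Gamma[w'/w]\vdash\Delta[w'/w]$ infer $(\epsilon,w\triangleright w');\Gamma\vdash\Delta$ ($w\neq\epsilon$). $Eq_2$: from $(\epsilon,w'\triangleright w');\Gamma[w'/w]\vdash\Delta[w'/w]$ infer $(\epsilon,w'\triangleright w);\Gamma\vdash\Delta$ ($w\neq\epsilon$). -}

module Defs where

open import Data.Nat using (ℕ)
open import Data.Bool using (Bool; true; false)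
open import Data.List using (List; []; _∷_; _++_; map)
open import Data.List.Membership.Propositional using (_∈_)
open import Data.List.Relation.Binary.Permutation.Propositional using (_↭_)
open import Data.Product using (_×_; _,_)
open import Relation.Binary.PropositionalEquality using (_≡_)
open import Relation.Nullary using (¬_)
open import Relation.Nullary.Decidable using (⌊_⌋)
open import Data.Nat using (_≟_)

infixr 6 _∧_ _∗_
infixr 5 _⇒_ _−∗_

data Form : Set where
  atom : ℕ → Form
  ⊤ᶠ   : Form
  ⊥ᶠ   : Form
  _∧_  : Form → Form → Form
  _⇒_  : Form → Form → Form
  ⊤*   : Form
  _∗_  : Form → Form → Form
  _−∗_ : Form → Form → Form

¬ᶠ : Form → Form
¬ᶠ A = A ⇒ ⊥ᶠ

_∨_ : Form → Form → Form
A ∨ B = ¬ᶠ (¬ᶠ A ∧ ¬ᶠ B)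

data Label : Set where
  ε   : Label
  var : ℕ → Label

data LItem : Set where
  _⦂_   : Label → Form → LItem
  ⟨_,_▷_⟩ : Label → Label → Label → LItem

data RItem : Set where
  _⦂_ : Label → Form → RItem

_≟L_ : Label → Label → Bool
ε     ≟L ε     = true
ε     ≟L var _ = false
var _ ≟L ε     = false
var m ≟L var n = ⌊ m ≟ n ⌋

substL : Label → Label → Label → Label
substL y x w with w ≟L x
... | true  = y
... | false = w

substLI : Label → Label → LItem → LItem
substLI y x (w ⦂ A)       = substL y x w ⦂ A
substLI y x ⟨ a , b ▷ c ⟩ = ⟨ substL y x a , substL y x b ▷ substL y x c ⟩

substRI : Label → Label → RItem → RItem
substRI y x (w ⦂ A) = substL y x w ⦂ A

_[_/_]ˡ : List LItem → Label → Label → List LItem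
Γ [ y / x ]ˡ = map (substLI y x) Γ

_[_/_]ʳ : List RItem → Label → Label → List RItem
Δ [ y / x ]ʳ = map (substRI y x) Δ

labelsLI : LItem → List Label
labelsLI (w ⦂ _)        = w ∷ []
labelsLI ⟨ a , b ▷ c ⟩  = a ∷ b ∷ c ∷ []

labelsRI : RItem → List Label
labelsRI (w ⦂ _) = w ∷ []

labelsL : List LItem → List Label
labelsL []      = []
labelsL (i ∷ Γ) = labelsLI i ++ labelsL Γ

labelsR : List RItem → List Label
labelsR []      = []
labelsR (i ∷ Δ) = labelsRI i ++ labelsR Δ

FreshIn : ℕ → List LItem → List RItem → Set
FreshIn n Γ Δ = ¬ (var n ∈ labelsL Γ) × ¬ (var n ∈ labelsR Δ)

-- Sequents are pairs of lists; the multiset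
-- reading is recovered by the structural rule `perm` (a list may be
-- replaced by any permutation of itself).  The Bool index says whether
-- the cut rule may be used: LS true = LS_BBI, LS false = cut-free LS_BBI.

infix 4 LS

data LS (cutOK : Bool) : List LItem → List RItem → Set where
  perm : ∀ {Γ Γ' Δ Δ'} → Γ ↭ Γ' → Δ ↭ Δ' → LS cutOK Γ Δ → LS cutOK Γ' Δ'

  id   : ∀ {Γ Δ w P} → LS cutOK ((w ⦂ atom P) ∷ Γ) ((w ⦂ atom P) ∷ Δ)
  ⊥L   : ∀ {Γ Δ w} → LS cutOK ((w ⦂ ⊥ᶠ) ∷ Γ) Δ
  ⊤R   : ∀ {Γ Δ w} → LS cutOK Γ ((w ⦂ ⊤ᶠ) ∷ Δ)
  ⊤*R  : ∀ {Γ Δ} → LS cutOK Γ ((ε ⦂ ⊤*) ∷ Δ)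

  cut  : ∀ {Γ Γ' Δ Δ' x A} → cutOK ≡ true →
         LS cutOK Γ ((x ⦂ A) ∷ Δ) → LS cutOK ((x ⦂ A) ∷ Γ') Δ' →
         LS cutOK (Γ ++ Γ') (Δ ++ Δ')

  ⊤*L  : ∀ {Γ Δ w} → ¬ (w ≡ ε) →
         LS cutOK (Γ [ ε / w ]ˡ) (Δ [ ε / w ]ʳ) →
         LS cutOK ((w ⦂ ⊤*) ∷ Γ) Δ

  ∧L   : ∀ {Γ Δ w A B} → LS cutOK ((w ⦂ A) ∷ (w ⦂ B) ∷ Γ) Δ →
         LS cutOK ((w ⦂ (A ∧ B)) ∷ Γ) Δ
  ∧R   : ∀ {Γ Δ w A B} → LS cutOK Γ ((w ⦂ A) ∷ Δ) → LS cutOK Γ ((w ⦂ B) ∷ Δ) →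
         LS cutOK Γ ((w ⦂ (A ∧ B)) ∷ Δ)
  ⇒L   : ∀ {Γ Δ w A B} → LS cutOK Γ ((w ⦂ A) ∷ Δ) → LS cutOK ((w ⦂ B) ∷ Γ) Δ →
         LS cutOK ((w ⦂ (A ⇒ B)) ∷ Γ) Δ
  ⇒R   : ∀ {Γ Δ w A B} → LS cutOK ((w ⦂ A) ∷ Γ) ((w ⦂ B) ∷ Δ) →
         LS cutOK Γ ((w ⦂ (A ⇒ B)) ∷ Δ)

  ∗L   : ∀ {Γ Δ z A B x y} → ¬ (x ≡ y) →
         FreshIn x ((z ⦂ (A ∗ B)) ∷ Γ) Δ → FreshIn y ((z ⦂ (A ∗ B)) ∷ Γ) Δ →
         LS cutOK (⟨ var x , var y ▷ z ⟩ ∷ (var x ⦂ A) ∷ (var y ⦂ B) ∷ Γ) Δ →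
         LS cutOK ((z ⦂ (A ∗ B)) ∷ Γ) Δ
  −∗R  : ∀ {Γ Δ y A B x z} → ¬ (x ≡ z) →
         FreshIn x Γ ((y ⦂ (A −∗ B)) ∷ Δ) → FreshIn z Γ ((y ⦂ (A −∗ B)) ∷ Δ) →
         LS cutOK (⟨ var x , y ▷ var z ⟩ ∷ (var x ⦂ A) ∷ Γ) ((var z ⦂ B) ∷ Δ) →
         LS cutOK Γ ((y ⦂ (A −∗ B)) ∷ Δ)
  ∗R   : ∀ {Γ Δ x y z A B} →
         LS cutOK (⟨ x , y ▷ z ⟩ ∷ Γ) ((x ⦂ A) ∷ (z ⦂ (A ∗ B)) ∷ Δ) →
         LS cutOK (⟨ x , y ▷ z ⟩ ∷ Γ) ((y ⦂ B) ∷ (z ⦂ (A ∗ B)) ∷ Δ) →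
         LS cutOK (⟨ x , y ▷ z ⟩ ∷ Γ) ((z ⦂ (A ∗ B)) ∷ Δ)
  −∗L  : ∀ {Γ Δ x y z A B} →
         LS cutOK (⟨ x , y ▷ z ⟩ ∷ (y ⦂ (A −∗ B)) ∷ Γ) ((x ⦂ A) ∷ Δ) →
         LS cutOK (⟨ x , y ▷ z ⟩ ∷ (y ⦂ (A −∗ B)) ∷ (z ⦂ B) ∷ Γ) Δ →
         LS cutOK (⟨ x , y ▷ z ⟩ ∷ (y ⦂ (A −∗ B)) ∷ Γ) Δ

  E    : ∀ {Γ Δ x y z} →
         LS cutOK (⟨ y , x ▷ z ⟩ ∷ ⟨ x , y ▷ z ⟩ ∷ Γ) Δ →
         LS cutOK (⟨ x , y ▷ z ⟩ ∷ Γ) Δ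
  U    : ∀ {Γ Δ x} →
         LS cutOK (⟨ x , ε ▷ x ⟩ ∷ Γ) Δ →
         LS cutOK Γ Δ
  A    : ∀ {Γ Δ x y z u v w} →
         FreshIn w (⟨ x , y ▷ z ⟩ ∷ ⟨ u , v ▷ x ⟩ ∷ Γ) Δ →
         LS cutOK (⟨ u , var w ▷ z ⟩ ∷ ⟨ y , v ▷ var w ⟩ ∷ ⟨ x , y ▷ z ⟩ ∷ ⟨ u , v ▷ x ⟩ ∷ Γ) Δ →
         LS cutOK (⟨ x , y ▷ z ⟩ ∷ ⟨ u , v ▷ x ⟩ ∷ Γ) Δ
  AC   : ∀ {Γ Δ x y w} →
         FreshIn w (⟨ x , y ▷ x ⟩ ∷ Γ) Δ →
         LS cutOK (⟨ x , var w ▷ x ⟩ ∷ ⟨ y , y ▷ var w ⟩ ∷ ⟨ x , y ▷ x ⟩ ∷ Γ) Δ →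
         LS cutOK (⟨ x , y ▷ x ⟩ ∷ Γ) Δ
  Eq₁  : ∀ {Γ Δ w w'} → ¬ (w ≡ ε) →
         LS cutOK (⟨ ε , w' ▷ w' ⟩ ∷ (Γ [ w' / w ]ˡ)) (Δ [ w' / w ]ʳ) →
         LS cutOK (⟨ ε , w ▷ w' ⟩ ∷ Γ) Δ
  Eq₂  : ∀ {Γ Δ w w'} → ¬ (w ≡ ε) →
         LS cutOK (⟨ ε , w' ▷ w' ⟩ ∷ (Γ [ w' / w ]ˡ)) (Δ [ w' / w ]ʳ) →
         LS cutOK (⟨ ε , w' ▷ w ⟩ ∷ Γ) Δ

Derivable : List LItem → List RItem → Set
Derivable Γ Δ = LS true Γ Δ

CutFreeDerivable : List LItem → List RItem → Set
CutFreeDerivable Γ Δ = LS false Γ Δ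

-- Cut is eliminated through a height-indexed calculus G3 that reads contexts
-- as sets: a rule applies to any item occurring in the sequent and keeps that
-- item in its premises. In G3 weakening and contraction are height-preserving,
-- and so is the application of any label map fixing ε; eigenvariable
-- conditions are restored by renaming to fresh variables. A cut on x : F is
-- eliminated by induction on F and, inside, on the left derivation until
-- x : F is principal there and then on the right one until it is principal
-- there as well; the principal cut is replaced by cuts on the immediate
-- subformulas of F. Both inner inductions carry a label map and context
-- inclusions for each side, so the substitutions made by ⊤*L, Eq₁, Eq₂ and
-- the eigenvariable rules are absorbed rather than re-derived. Finally a
-- cut-free G3 derivation is read back into LS, using the height-preserving
-- invertibility of the rules that consume their principal item to discard
-- the copies G3 keeps.

module Submission where

open import Defs
open import Data.Bool using (Bool; true; false)
open import Data.Empty using (⊥-elim)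
open import Data.List using (List; []; _∷_; _++_; map)
open import Data.List.Membership.Propositional using (_∈_)
open import Data.List.Membership.Propositional.Properties using (∈-map⁺; ∈-++⁺ˡ; ∈-++⁺ʳ; ∈-++⁻; ∈-∃++)
open import Data.List.Properties using (map-cong)
open import Data.List.Relation.Unary.Any using (here; there)
open import Data.List.Relation.Binary.Permutation.Propositional using (_↭_; ↭-sym; ↭-trans; ↭-prep; ↭-swap; ↭-refl; ↭-reflexive)
open import Data.List.Relation.Binary.Permutation.Propositional.Properties using (∈-resp-↭; shift) renaming (map⁺ to ↭-map⁺)
open import Data.List.Relation.Binary.Subset.Propositional using (_⊆_)
open import Data.List.Relation.Binary.Subset.Propositional.Properties using (⊆-refl; ⊆-reflexive; ⊆-reflexive-↭; xs⊆x∷xs; ∷⁺ʳ; ∈-∷⁺ʳ; xs⊆xs++ys; xs⊆ys++xs) renaming (map⁺ to ⊆-map⁺)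
open import Data.Nat using (ℕ; zero; suc; _≤_; _⊔_; s≤s) renaming (_≟_ to _≟ℕ_)
open import Data.Nat.Properties using (m≤m⊔n; m≤n⊔m; n≤1+n; ≤-trans; <-irrefl)
open import Data.Product using (Σ; _×_; _,_; proj₁; proj₂)
open import Data.Sum using (_⊎_; inj₁; inj₂; [_,_]′; fromInj₂) renaming (map to ⊎-map; swap to ⊎-swap)
open import Relation.Nullary using (¬_; yes; no; Dec)
open import Relation.Binary.PropositionalEquality using (_≡_; refl; sym; trans; cong; cong₂; subst)

-- Labels, label maps and fresh variables

var-injective : ∀ {m n} → var m ≡ var n → m ≡ n
var-injective refl = refl

_≟ℓ_ : (a b : Label) → Dec (a ≡ b)
ε ≟ℓ ε = yes refl
ε ≟ℓ var _ = no (λ ())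
var _ ≟ℓ ε = no (λ ())
var m ≟ℓ var n with m ≟ℕ n
... | yes refl = yes refl
... | no m≢n = no (λ e → m≢n (var-injective e))

≟L-refl : ∀ a → (a ≟L a) ≡ true
≟L-refl ε = refl
≟L-refl (var n) with n ≟ℕ n
... | yes _ = refl
... | no n≢n = ⊥-elim (n≢n refl)

≟L-false : ∀ a b → ¬ (a ≡ b) → (a ≟L b) ≡ false
≟L-false ε ε a≢b = ⊥-elim (a≢b refl)
≟L-false ε (var _) _ = refl
≟L-false (var _) ε _ = refl
≟L-false (var m) (var n) a≢b with m ≟ℕ n
... | yes refl = ⊥-elim (a≢b refl)
... | no _ = refl

substL-hit : ∀ y x → substL y x x ≡ y
substL-hit y x with x ≟L x | ≟L-refl x
... | true | _ = refl
... | false | ()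

substL-miss : ∀ y x w → ¬ (w ≡ x) → substL y x w ≡ w
substL-miss y x w w≢x with w ≟L x | ≟L-false w x w≢x
... | false | _ = refl
... | true | ()

substL-ε : ∀ y x → ¬ (x ≡ ε) → substL y x ε ≡ ε
substL-ε y x x≢ε = substL-miss y x ε (λ e → x≢ε (sym e))

substL-self : ∀ y x → substL y x y ≡ y
substL-self y x with y ≟ℓ x
... | yes refl = substL-hit y y
... | no y≢x = substL-miss y x y y≢x

update : (Label → Label) → ℕ → Label → Label → Label
update σ n t l with l ≟L var n
... | true = t
... | false = σ l

update-hit : ∀ σ n t → update σ n t (var n) ≡ t
update-hit σ n t with var n ≟L var n | ≟L-refl (var n)
... | true | _ = refl
... | false | ()

update-miss : ∀ σ n t l → ¬ (l ≡ var n) → update σ n t l ≡ σ l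
update-miss σ n t l l≢n with l ≟L var n | ≟L-false l (var n) l≢n
... | false | _ = refl
... | true | ()

∉⇒≢ : ∀ {a : ℕ} {ls : List Label} {l} → ¬ (var a ∈ ls) → l ∈ ls → ¬ (l ≡ var a)
∉⇒≢ a∉ l∈ refl = a∉ l∈

update-∈ : ∀ σ a t {l} {ls : List Label} → ¬ (var a ∈ ls) → l ∈ ls → update σ a t l ≡ σ l
update-∈ σ a t a∉ l∈ = update-miss σ a t _ (∉⇒≢ a∉ l∈)

mapLI : (Label → Label) → LItem → LItem
mapLI f (w ⦂ F) = f w ⦂ F
mapLI f ⟨ a , b ▷ c ⟩ = ⟨ f a , f b ▷ f c ⟩

mapRI : (Label → Label) → RItem → RItem
mapRI f (w ⦂ F) = f w ⦂ F

mapL : (Label → Label) → List LItem → List LItem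
mapL f = map (mapLI f)

mapR : (Label → Label) → List RItem → List RItem
mapR f = map (mapRI f)

substˡ : Label → Label → List LItem → List LItem
substˡ y x = mapL (substL y x)

substʳ : Label → Label → List RItem → List RItem
substʳ y x = mapR (substL y x)

substLI≡mapLI : ∀ y x e → substLI y x e ≡ mapLI (substL y x) e
substLI≡mapLI y x (w ⦂ F) = refl
substLI≡mapLI y x ⟨ a , b ▷ c ⟩ = refl

substRI≡mapRI : ∀ y x e → substRI y x e ≡ mapRI (substL y x) e
substRI≡mapRI y x (w ⦂ F) = refl

[/]ˡ≡substˡ : ∀ y x Γ → Γ [ y / x ]ˡ ≡ substˡ y x Γ
[/]ˡ≡substˡ y x Γ = map-cong (substLI≡mapLI y x) Γ

[/]ʳ≡substʳ : ∀ y x Δ → Δ [ y / x ]ʳ ≡ substʳ y x Δ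
[/]ʳ≡substʳ y x Δ = map-cong (substRI≡mapRI y x) Δ

mapLI-∘ : ∀ f g e → mapLI f (mapLI g e) ≡ mapLI (λ l → f (g l)) e
mapLI-∘ f g (w ⦂ F) = refl
mapLI-∘ f g ⟨ a , b ▷ c ⟩ = refl

mapRI-∘ : ∀ f g e → mapRI f (mapRI g e) ≡ mapRI (λ l → f (g l)) e
mapRI-∘ f g (w ⦂ F) = refl

mapL-∘ : ∀ f g Γ → mapL f (mapL g Γ) ≡ mapL (λ l → f (g l)) Γ
mapL-∘ f g [] = refl
mapL-∘ f g (e ∷ Γ) = cong₂ _∷_ (mapLI-∘ f g e) (mapL-∘ f g Γ)

mapR-∘ : ∀ f g Δ → mapR f (mapR g Δ) ≡ mapR (λ l → f (g l)) Δ
mapR-∘ f g [] = refl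
mapR-∘ f g (e ∷ Δ) = cong₂ _∷_ (mapRI-∘ f g e) (mapR-∘ f g Δ)

mapLI-agree : ∀ f g e → (∀ l → l ∈ labelsLI e → f l ≡ g l) → mapLI f e ≡ mapLI g e
mapLI-agree f g (w ⦂ F) h = cong (_⦂ F) (h w (here refl))
mapLI-agree f g ⟨ a , b ▷ c ⟩ h
  rewrite h a (here refl) | h b (there (here refl)) | h c (there (there (here refl))) = refl

mapL-agree : ∀ f g Γ → (∀ l → l ∈ labelsL Γ → f l ≡ g l) → mapL f Γ ≡ mapL g Γ
mapL-agree f g [] h = refl
mapL-agree f g (e ∷ Γ) h =
  cong₂ _∷_ (mapLI-agree f g e (λ l m → h l (∈-++⁺ˡ m)))
            (mapL-agree f g Γ (λ l m → h l (∈-++⁺ʳ (labelsLI e) m)))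

mapR-agree : ∀ f g Δ → (∀ l → l ∈ labelsR Δ → f l ≡ g l) → mapR f Δ ≡ mapR g Δ
mapR-agree f g [] h = refl
mapR-agree f g ((w ⦂ F) ∷ Δ) h =
  cong₂ _∷_ (cong (_⦂ F) (h w (here refl))) (mapR-agree f g Δ (λ l m → h l (there m)))

mapL-id : ∀ Γ → mapL (λ l → l) Γ ≡ Γ
mapL-id [] = refl
mapL-id ((w ⦂ F) ∷ Γ) = cong (_ ∷_) (mapL-id Γ)
mapL-id (⟨ a , b ▷ c ⟩ ∷ Γ) = cong (_ ∷_) (mapL-id Γ)

mapR-id : ∀ Δ → mapR (λ l → l) Δ ≡ Δ
mapR-id [] = refl
mapR-id ((w ⦂ F) ∷ Δ) = cong (_ ∷_) (mapR-id Δ)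

∈-mapL : ∀ f {e Γ} → e ∈ Γ → mapLI f e ∈ mapL f Γ
∈-mapL f = ∈-map⁺ (mapLI f)

∈-mapR : ∀ f {e Δ} → e ∈ Δ → mapRI f e ∈ mapR f Δ
∈-mapR f = ∈-map⁺ (mapRI f)

⊆-mapL : ∀ f {Γ Γ'} → Γ ⊆ Γ' → mapL f Γ ⊆ mapL f Γ'
⊆-mapL f = ⊆-map⁺ (mapLI f)

⊆-mapR : ∀ f {Δ Δ'} → Δ ⊆ Δ' → mapR f Δ ⊆ mapR f Δ'
⊆-mapR f = ⊆-map⁺ (mapRI f)

∈-labelsL : ∀ {e Γ l} → e ∈ Γ → l ∈ labelsLI e → l ∈ labelsL Γ
∈-labelsL {Γ = e ∷ Γ} (here refl) m = ∈-++⁺ˡ m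
∈-labelsL {Γ = e ∷ Γ} (there p) m = ∈-++⁺ʳ (labelsLI e) (∈-labelsL p m)

∈-labelsR : ∀ {e Δ l} → e ∈ Δ → l ∈ labelsRI e → l ∈ labelsR Δ
∈-labelsR {Δ = (w ⦂ F) ∷ Δ} (here refl) m = ∈-++⁺ˡ m
∈-labelsR {Δ = (w ⦂ F) ∷ Δ} (there p) m = there (∈-labelsR p m)

∈-labelsL⁻ : ∀ Γ {l} → l ∈ labelsL Γ → Σ LItem λ e → e ∈ Γ × l ∈ labelsLI e
∈-labelsL⁻ (e ∷ Γ) m with ∈-++⁻ (labelsLI e) m
... | inj₁ q = e , here refl , q
... | inj₂ q with ∈-labelsL⁻ Γ q
...   | e' , m' , q' = e' , there m' , q'

∈-labelsR⁻ : ∀ Δ {l} → l ∈ labelsR Δ → Σ RItem λ e → e ∈ Δ × l ∈ labelsRI e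
∈-labelsR⁻ ((w ⦂ F) ∷ Δ) (here eq) = (w ⦂ F) , here refl , here eq
∈-labelsR⁻ ((w ⦂ F) ∷ Δ) (there m) with ∈-labelsR⁻ Δ m
... | e' , m' , q' = e' , there m' , q'

FreshIn-↭ˡ : ∀ {a Γ Γ'} Δ → Γ' ↭ Γ → FreshIn a Γ Δ → FreshIn a Γ' Δ
FreshIn-↭ˡ {Γ' = Γ'} Δ p (f1 , f2) =
  (λ m → let (e , me , le) = ∈-labelsL⁻ Γ' m in f1 (∈-labelsL (∈-resp-↭ p me) le)) , f2

FreshIn-↭ʳ : ∀ {a Δ Δ'} Γ → Δ' ↭ Δ → FreshIn a Γ Δ → FreshIn a Γ Δ'
FreshIn-↭ʳ {Δ' = Δ'} Γ q (f1 , f2) =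
  f1 , (λ m → let (e , me , le) = ∈-labelsR⁻ Δ' m in f2 (∈-labelsR (∈-resp-↭ q me) le))

maxVar : List Label → ℕ
maxVar [] = 0
maxVar (ε ∷ ls) = maxVar ls
maxVar (var n ∷ ls) = n ⊔ maxVar ls

maxVar-≥ : ∀ {n ls} → var n ∈ ls → n ≤ maxVar ls
maxVar-≥ {ls = ε ∷ ls} (here ())
maxVar-≥ {ls = ε ∷ ls} (there m) = maxVar-≥ m
maxVar-≥ {n} {var k ∷ ls} (here refl) = m≤m⊔n n (maxVar ls)
maxVar-≥ {n} {var k ∷ ls} (there m) = ≤-trans (maxVar-≥ m) (m≤n⊔m k (maxVar ls))

fresh : List Label → ℕ
fresh ls = suc (maxVar ls)

fresh∉ : ∀ ls → ¬ (var (fresh ls) ∈ ls)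
fresh∉ ls m = <-irrefl refl (maxVar-≥ m)

freshFor : List Label → List LItem → List RItem → ℕ
freshFor avoid Γ Δ = fresh (avoid ++ labelsL Γ ++ labelsR Δ)

freshFor∉ : ∀ avoid Γ Δ → ¬ (var (freshFor avoid Γ Δ) ∈ avoid)
freshFor∉ avoid Γ Δ m = fresh∉ (avoid ++ labelsL Γ ++ labelsR Δ) (∈-++⁺ˡ m)

freshFor-FreshIn : ∀ avoid Γ Δ → FreshIn (freshFor avoid Γ Δ) Γ Δ
freshFor-FreshIn avoid Γ Δ =
  (λ m → fresh∉ (avoid ++ labelsL Γ ++ labelsR Δ) (∈-++⁺ʳ avoid (∈-++⁺ˡ m))) ,
  (λ m → fresh∉ (avoid ++ labelsL Γ ++ labelsR Δ) (∈-++⁺ʳ avoid (∈-++⁺ʳ (labelsL Γ) m)))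

freshPair : List LItem → List RItem → ℕ × ℕ
freshPair Γ Δ = freshFor [] Γ Δ , freshFor (var (freshFor [] Γ Δ) ∷ []) Γ Δ

freshPair-distinct : ∀ Γ Δ → ¬ (proj₁ (freshPair Γ Δ) ≡ proj₂ (freshPair Γ Δ))
freshPair-distinct Γ Δ e = freshFor∉ (var (freshFor [] Γ Δ) ∷ []) Γ Δ (here (cong var (sym e)))

-- The calculus G3

variable
  c : Bool
  n m : ℕ
  Γ Γ' : List LItem
  Δ Δ' : List RItem
  w w' x y z u v : Label
  B C : Form
  p a b : ℕ

EqAtom : List LItem → Label → Label → Set
EqAtom Γ w w' = ⟨ ε , w ▷ w' ⟩ ∈ Γ ⊎ ⟨ ε , w' ▷ w ⟩ ∈ Γ

-- G3 c n Γ Δ: derivations of height at most n. Eq₁ and Eq₂ are merged into gEq.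
infix 4 G3
data G3 (c : Bool) : ℕ → List LItem → List RItem → Set where
  gid  : (w ⦂ atom p) ∈ Γ → (w ⦂ atom p) ∈ Δ → G3 c (suc n) Γ Δ
  g⊥L  : (w ⦂ ⊥ᶠ) ∈ Γ → G3 c (suc n) Γ Δ
  g⊤R  : (w ⦂ ⊤ᶠ) ∈ Δ → G3 c (suc n) Γ Δ
  g⊤*R : (ε ⦂ ⊤*) ∈ Δ → G3 c (suc n) Γ Δ
  gcut : c ≡ true → G3 c n Γ ((w ⦂ B) ∷ Δ) → G3 c n ((w ⦂ B) ∷ Γ) Δ → G3 c (suc n) Γ Δ
  g⊤*L : (w ⦂ ⊤*) ∈ Γ → ¬ (w ≡ ε) → G3 c n (substˡ ε w Γ) (substʳ ε w Δ) → G3 c (suc n) Γ Δ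
  g∧L  : (w ⦂ (B ∧ C)) ∈ Γ → G3 c n ((w ⦂ B) ∷ (w ⦂ C) ∷ Γ) Δ → G3 c (suc n) Γ Δ
  g∧R  : (w ⦂ (B ∧ C)) ∈ Δ → G3 c n Γ ((w ⦂ B) ∷ Δ) → G3 c n Γ ((w ⦂ C) ∷ Δ) → G3 c (suc n) Γ Δ
  g⇒L  : (w ⦂ (B ⇒ C)) ∈ Γ → G3 c n Γ ((w ⦂ B) ∷ Δ) → G3 c n ((w ⦂ C) ∷ Γ) Δ → G3 c (suc n) Γ Δ
  g⇒R  : (w ⦂ (B ⇒ C)) ∈ Δ → G3 c n ((w ⦂ B) ∷ Γ) ((w ⦂ C) ∷ Δ) → G3 c (suc n) Γ Δ
  g∗L  : (z ⦂ (B ∗ C)) ∈ Γ → ¬ (a ≡ b) → FreshIn a Γ Δ → FreshIn b Γ Δ →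
         G3 c n (⟨ var a , var b ▷ z ⟩ ∷ (var a ⦂ B) ∷ (var b ⦂ C) ∷ Γ) Δ → G3 c (suc n) Γ Δ
  g−∗R : (y ⦂ (B −∗ C)) ∈ Δ → ¬ (a ≡ b) → FreshIn a Γ Δ → FreshIn b Γ Δ →
         G3 c n (⟨ var a , y ▷ var b ⟩ ∷ (var a ⦂ B) ∷ Γ) ((var b ⦂ C) ∷ Δ) → G3 c (suc n) Γ Δ
  g∗R  : ⟨ x , y ▷ z ⟩ ∈ Γ → (z ⦂ (B ∗ C)) ∈ Δ →
         G3 c n Γ ((x ⦂ B) ∷ Δ) → G3 c n Γ ((y ⦂ C) ∷ Δ) → G3 c (suc n) Γ Δ
  g−∗L : ⟨ x , y ▷ z ⟩ ∈ Γ → (y ⦂ (B −∗ C)) ∈ Γ →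
         G3 c n Γ ((x ⦂ B) ∷ Δ) → G3 c n ((z ⦂ C) ∷ Γ) Δ → G3 c (suc n) Γ Δ
  gE   : ⟨ x , y ▷ z ⟩ ∈ Γ → G3 c n (⟨ y , x ▷ z ⟩ ∷ Γ) Δ → G3 c (suc n) Γ Δ
  gU   : G3 c n (⟨ x , ε ▷ x ⟩ ∷ Γ) Δ → G3 c (suc n) Γ Δ
  gA   : ⟨ x , y ▷ z ⟩ ∈ Γ → ⟨ u , v ▷ x ⟩ ∈ Γ → FreshIn a Γ Δ →
         G3 c n (⟨ u , var a ▷ z ⟩ ∷ ⟨ y , v ▷ var a ⟩ ∷ Γ) Δ → G3 c (suc n) Γ Δ
  gAC  : ⟨ x , y ▷ x ⟩ ∈ Γ → FreshIn a Γ Δ →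
         G3 c n (⟨ x , var a ▷ x ⟩ ∷ ⟨ y , y ▷ var a ⟩ ∷ Γ) Δ → G3 c (suc n) Γ Δ
  gEq  : EqAtom Γ w w' → ¬ (w ≡ ε) →
         G3 c n (substˡ w' w Γ) (substʳ w' w Δ) → G3 c (suc n) Γ Δ

castG3 : Γ ≡ Γ' → Δ ≡ Δ' → G3 c n Γ Δ → G3 c n Γ' Δ'
castG3 refl refl d = d

raise≤ : m ≤ n → G3 c m Γ Δ → G3 c n Γ Δ
raise≤ (s≤s _) (gid m1 m2) = gid m1 m2
raise≤ (s≤s _) (g⊥L m) = g⊥L m
raise≤ (s≤s _) (g⊤R m) = g⊤R m
raise≤ (s≤s _) (g⊤*R m) = g⊤*R m
raise≤ (s≤s le) (gcut e d1 d2) = gcut e (raise≤ le d1) (raise≤ le d2)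
raise≤ (s≤s le) (g⊤*L m w≢ε d) = g⊤*L m w≢ε (raise≤ le d)
raise≤ (s≤s le) (g∧L m d) = g∧L m (raise≤ le d)
raise≤ (s≤s le) (g∧R m d1 d2) = g∧R m (raise≤ le d1) (raise≤ le d2)
raise≤ (s≤s le) (g⇒L m d1 d2) = g⇒L m (raise≤ le d1) (raise≤ le d2)
raise≤ (s≤s le) (g⇒R m d) = g⇒R m (raise≤ le d)
raise≤ (s≤s le) (g∗L m a≢b fa fb d) = g∗L m a≢b fa fb (raise≤ le d)
raise≤ (s≤s le) (g−∗R m a≢b fa fb d) = g−∗R m a≢b fa fb (raise≤ le d)
raise≤ (s≤s le) (g∗R m1 m2 d1 d2) = g∗R m1 m2 (raise≤ le d1) (raise≤ le d2)
raise≤ (s≤s le) (g−∗L m1 m2 d1 d2) = g−∗L m1 m2 (raise≤ le d1) (raise≤ le d2)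
raise≤ (s≤s le) (gE m d) = gE m (raise≤ le d)
raise≤ (s≤s le) (gU d) = gU (raise≤ le d)
raise≤ (s≤s le) (gA m1 m2 fa d) = gA m1 m2 fa (raise≤ le d)
raise≤ (s≤s le) (gAC m fa d) = gAC m fa (raise≤ le d)
raise≤ (s≤s le) (gEq m w≢ε d) = gEq m w≢ε (raise≤ le d)

raise : G3 c n Γ Δ → G3 c (suc n) Γ Δ
raise = raise≤ (n≤1+n _)

Der : Bool → List LItem → List RItem → Set
Der c Γ Δ = Σ ℕ λ n → G3 c n Γ Δ

rule₁ : ∀ {Γ₁ Δ₁} → (∀ {n} → G3 c n Γ₁ Δ₁ → G3 c (suc n) Γ Δ) → Der c Γ₁ Δ₁ → Der c Γ Δ
rule₁ r (n , d) = suc n , r d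

rule₂ : ∀ {Γ₁ Δ₁ Γ₂ Δ₂} → (∀ {n} → G3 c n Γ₁ Δ₁ → G3 c n Γ₂ Δ₂ → G3 c (suc n) Γ Δ) →
        Der c Γ₁ Δ₁ → Der c Γ₂ Δ₂ → Der c Γ Δ
rule₂ r (n₁ , d₁) (n₂ , d₂) = suc (n₁ ⊔ n₂) , r (raise≤ (m≤m⊔n n₁ n₂) d₁) (raise≤ (m≤n⊔m n₁ n₂) d₂)

-- Substitution and renaming in G3

⟨⟩-cong : ∀ {a a' b b' c c'} → a ≡ a' → b ≡ b' → c ≡ c' → ⟨ a , b ▷ c ⟩ ≡ ⟨ a' , b' ▷ c' ⟩
⟨⟩-cong refl refl refl = refl

⦂-congˡ : ∀ {a a' F} → a ≡ a' → _≡_ {A = LItem} (a ⦂ F) (a' ⦂ F)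
⦂-congˡ refl = refl

⦂-congʳ : ∀ {a a' F} → a ≡ a' → _≡_ {A = RItem} (a ⦂ F) (a' ⦂ F)
⦂-congʳ refl = refl

∘substL-absorb : ∀ (f : Label → Label) v w → f v ≡ f w → ∀ l → f (substL v w l) ≡ f l
∘substL-absorb f v w e l with l ≟ℓ w
... | yes refl = trans (cong f (substL-hit v w)) e
... | no l≢w = cong f (substL-miss v w l l≢w)

substL-identifies : ∀ y x → substL y x y ≡ substL y x x
substL-identifies y x = trans (substL-self y x) (sym (substL-hit y x))

mapL-absorb : ∀ (f s : Label → Label) Γ → (∀ l → f (s l) ≡ f l) → mapL f (mapL s Γ) ≡ mapL f Γ
mapL-absorb f s Γ h = trans (mapL-∘ f s Γ) (mapL-agree _ _ Γ (λ l _ → h l))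

mapR-absorb : ∀ (f s : Label → Label) Δ → (∀ l → f (s l) ≡ f l) → mapR f (mapR s Δ) ≡ mapR f Δ
mapR-absorb f s Δ h = trans (mapR-∘ f s Δ) (mapR-agree _ _ Δ (λ l _ → h l))

mapL-∘˘ : ∀ (t σ : Label → Label) Γ → mapL (λ l → t (σ l)) Γ ≡ mapL t (mapL σ Γ)
mapL-∘˘ t σ Γ = sym (mapL-∘ t σ Γ)

mapR-∘˘ : ∀ (t σ : Label → Label) Δ → mapR (λ l → t (σ l)) Δ ≡ mapR t (mapR σ Δ)
mapR-∘˘ t σ Δ = sym (mapR-∘ t σ Δ)

mapL-∘-absorb : ∀ (t σ s : Label → Label) Γ → (∀ l → t (σ (s l)) ≡ t (σ l)) →
                mapL (λ l → t (σ l)) (mapL s Γ) ≡ mapL t (mapL σ Γ)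
mapL-∘-absorb t σ s Γ h = trans (mapL-absorb _ s Γ h) (mapL-∘˘ t σ Γ)

mapR-∘-absorb : ∀ (t σ s : Label → Label) Δ → (∀ l → t (σ (s l)) ≡ t (σ l)) →
                mapR (λ l → t (σ l)) (mapR s Δ) ≡ mapR t (mapR σ Δ)
mapR-∘-absorb t σ s Δ h = trans (mapR-absorb _ s Δ h) (mapR-∘˘ t σ Δ)

⊤*R-mapR : ∀ σ → σ ε ≡ ε → (ε ⦂ ⊤*) ∈ Δ → (ε ⦂ ⊤*) ∈ mapR σ Δ
⊤*R-mapR {Δ = Δ} σ σε m = subst (λ l → (l ⦂ ⊤*) ∈ mapR σ Δ) σε (∈-mapR σ m)

EqAtom-mapL : ∀ σ → σ ε ≡ ε → EqAtom Γ w w' → EqAtom (mapL σ Γ) (σ w) (σ w')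
EqAtom-mapL {Γ = Γ} σ σε = ⊎-map (ε▷-mapL) (ε▷-mapL)
  where
  ε▷-mapL : ∀ {a b} → ⟨ ε , a ▷ b ⟩ ∈ Γ → ⟨ ε , σ a ▷ σ b ⟩ ∈ mapL σ Γ
  ε▷-mapL {a} {b} m = subst (λ l → ⟨ l , σ a ▷ σ b ⟩ ∈ mapL σ Γ) σε (∈-mapL σ m)

-- Pushing σ through the substitution in a ⊤*L or Eq premise: either σ already
-- identifies the two labels, or the substitution becomes one on their σ-images.
data SubstCaseε (σ : Label → Label) (w : Label) : Set where
  absorbedε : (∀ l → σ (substL ε w l) ≡ σ l) → SubstCaseε σ w
  renamedε  : ¬ (σ w ≡ ε) → (∀ l → substL ε (σ w) (σ (substL ε w l)) ≡ substL ε (σ w) (σ l)) → SubstCaseε σ w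

substCaseε : ∀ σ → σ ε ≡ ε → ∀ w → SubstCaseε σ w
substCaseε σ σε w with σ w ≟ℓ ε
... | yes σw≡ε = absorbedε (∘substL-absorb σ ε w (trans σε (sym σw≡ε)))
... | no σw≢ε = renamedε σw≢ε (∘substL-absorb (λ l → substL ε (σ w) (σ l)) ε w
                   (trans (cong (substL ε (σ w)) σε) (substL-identifies ε (σ w))))

data SubstCase (σ : Label → Label) (v w : Label) : Set where
  absorbed : (∀ l → σ (substL v w l) ≡ σ l) → SubstCase σ v w
  renamed  : ∀ {v' w'} → ¬ (w' ≡ ε) → (∀ {Γ} → EqAtom Γ (σ w) (σ v) → EqAtom Γ w' v') →
             (∀ l → substL v' w' (σ (substL v w l)) ≡ substL v' w' (σ l)) → SubstCase σ v w

-- When σ w ≡ ε the atom ⟨ ε , σ w ▷ σ v ⟩ must be used in the other direction.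
substCase : ∀ σ v w → SubstCase σ v w
substCase σ v w with σ v ≟ℓ σ w
... | yes e = absorbed (∘substL-absorb σ v w e)
... | no σv≢σw with σ w ≟ℓ ε
...   | no σw≢ε = renamed σw≢ε (λ e → e)
                    (∘substL-absorb (λ l → substL (σ v) (σ w) (σ l)) v w (substL-identifies (σ v) (σ w)))
...   | yes σw≡ε = renamed (λ σv≡ε → σv≢σw (trans σv≡ε (sym σw≡ε))) ⊎-swap
                    (∘substL-absorb (λ l → substL (σ w) (σ v) (σ l)) v w (sym (substL-identifies (σ w) (σ v))))

update-freshˡ : ∀ σ a t Γ → ¬ (var a ∈ labelsL Γ) → mapL (update σ a t) Γ ≡ mapL σ Γ
update-freshˡ σ a t Γ a∉ = mapL-agree _ _ Γ (λ l m → update-∈ σ a t a∉ m)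

update-freshʳ : ∀ σ a t Δ → ¬ (var a ∈ labelsR Δ) → mapR (update σ a t) Δ ≡ mapR σ Δ
update-freshʳ σ a t Δ a∉ = mapR-agree _ _ Δ (λ l m → update-∈ σ a t a∉ m)

module _ (σ : Label → Label) (a b : ℕ) (t₁ t₂ : Label) (a≢b : ¬ (a ≡ b)) where
  private
    σ' = update (update σ b t₂) a t₁

    σ'-a : σ' (var a) ≡ t₁
    σ'-a = update-hit _ a t₁

    σ'-b : σ' (var b) ≡ t₂
    σ'-b = trans (update-miss _ a t₁ (var b) (λ e → a≢b (sym (var-injective e)))) (update-hit σ b t₂)

    σ'-other : ∀ {l} → ¬ (l ≡ var a) → ¬ (l ≡ var b) → σ' l ≡ σ l
    σ'-other l≢a l≢b = trans (update-miss _ a t₁ _ l≢a) (update-miss σ b t₂ _ l≢b)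

  update₂-freshˡ : ∀ Γ → ¬ (var a ∈ labelsL Γ) → ¬ (var b ∈ labelsL Γ) → mapL σ' Γ ≡ mapL σ Γ
  update₂-freshˡ Γ a∉ b∉ = trans (update-freshˡ _ a t₁ Γ a∉) (update-freshˡ σ b t₂ Γ b∉)

  update₂-freshʳ : ∀ Δ → ¬ (var a ∈ labelsR Δ) → ¬ (var b ∈ labelsR Δ) → mapR σ' Δ ≡ mapR σ Δ
  update₂-freshʳ Δ a∉ b∉ = trans (update-freshʳ _ a t₁ Δ a∉) (update-freshʳ σ b t₂ Δ b∉)

  ∗L-eigen : ∀ z B C Γ → ¬ (var a ∈ labelsL Γ) → ¬ (var b ∈ labelsL Γ) → z ∈ labelsL Γ →
             mapL σ' (⟨ var a , var b ▷ z ⟩ ∷ (var a ⦂ B) ∷ (var b ⦂ C) ∷ Γ) ≡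
             ⟨ t₁ , t₂ ▷ σ z ⟩ ∷ (t₁ ⦂ B) ∷ (t₂ ⦂ C) ∷ mapL σ Γ
  ∗L-eigen z B C Γ a∉ b∉ z∈ =
    cong₂ _∷_ (⟨⟩-cong σ'-a σ'-b (σ'-other (∉⇒≢ a∉ z∈) (∉⇒≢ b∉ z∈)))
      (cong₂ _∷_ (⦂-congˡ σ'-a) (cong₂ _∷_ (⦂-congˡ σ'-b) (update₂-freshˡ Γ a∉ b∉)))

  −∗R-eigenˡ : ∀ y B Γ → ¬ (var a ∈ labelsL Γ) → ¬ (var b ∈ labelsL Γ) → ¬ (y ≡ var a) → ¬ (y ≡ var b) →
               mapL σ' (⟨ var a , y ▷ var b ⟩ ∷ (var a ⦂ B) ∷ Γ) ≡ ⟨ t₁ , σ y ▷ t₂ ⟩ ∷ (t₁ ⦂ B) ∷ mapL σ Γ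
  −∗R-eigenˡ y B Γ a∉ b∉ y≢a y≢b =
    cong₂ _∷_ (⟨⟩-cong σ'-a (σ'-other y≢a y≢b) σ'-b) (cong₂ _∷_ (⦂-congˡ σ'-a) (update₂-freshˡ Γ a∉ b∉))

  −∗R-eigenʳ : ∀ C Δ → ¬ (var a ∈ labelsR Δ) → ¬ (var b ∈ labelsR Δ) →
               mapR σ' ((var b ⦂ C) ∷ Δ) ≡ (t₂ ⦂ C) ∷ mapR σ Δ
  −∗R-eigenʳ C Δ a∉ b∉ = cong₂ _∷_ (⦂-congʳ σ'-b) (update₂-freshʳ Δ a∉ b∉)

A-labels : ⟨ x , y ▷ z ⟩ ∈ Γ → ⟨ u , v ▷ x ⟩ ∈ Γ → ∀ {l} → l ∈ (u ∷ z ∷ y ∷ v ∷ []) → l ∈ labelsL Γ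
A-labels m₁ m₂ (here refl) = ∈-labelsL m₂ (here refl)
A-labels m₁ m₂ (there (here refl)) = ∈-labelsL m₁ (there (there (here refl)))
A-labels m₁ m₂ (there (there (here refl))) = ∈-labelsL m₁ (there (here refl))
A-labels m₁ m₂ (there (there (there (here refl)))) = ∈-labelsL m₂ (there (here refl))

A-eigen : ∀ σ a t u z y v Γ → ¬ (var a ∈ labelsL Γ) → (∀ {l} → l ∈ (u ∷ z ∷ y ∷ v ∷ []) → l ∈ labelsL Γ) →
          mapL (update σ a t) (⟨ u , var a ▷ z ⟩ ∷ ⟨ y , v ▷ var a ⟩ ∷ Γ) ≡
          ⟨ σ u , t ▷ σ z ⟩ ∷ ⟨ σ y , σ v ▷ t ⟩ ∷ mapL σ Γ
A-eigen σ a t u z y v Γ a∉ labels =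
  cong₂ _∷_ (⟨⟩-cong (old (here refl)) new (old (there (here refl))))
    (cong₂ _∷_ (⟨⟩-cong (old (there (there (here refl)))) (old (there (there (there (here refl))))) new)
               (update-freshˡ σ a t Γ a∉))
  where
  new = update-hit σ a t
  old : ∀ {l} → l ∈ (u ∷ z ∷ y ∷ v ∷ []) → update σ a t l ≡ σ l
  old q = update-∈ σ a t a∉ (labels q)

fresh₁ fresh₂ : List LItem → List RItem → ℕ
fresh₁ Γ Δ = freshFor [] Γ Δ
fresh₂ Γ Δ = freshFor (var (fresh₁ Γ Δ) ∷ []) Γ Δ

fresh₁-FreshIn : ∀ Γ Δ → FreshIn (fresh₁ Γ Δ) Γ Δ
fresh₁-FreshIn = freshFor-FreshIn []

fresh₂-FreshIn : ∀ Γ Δ → FreshIn (fresh₂ Γ Δ) Γ Δ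
fresh₂-FreshIn Γ Δ = freshFor-FreshIn (var (fresh₁ Γ Δ) ∷ []) Γ Δ

fresh₁≢fresh₂ : ∀ Γ Δ → ¬ (fresh₁ Γ Δ ≡ fresh₂ Γ Δ)
fresh₁≢fresh₂ Γ Δ e = freshFor∉ (var (fresh₁ Γ Δ) ∷ []) Γ Δ (here (cong var (sym e)))

g∗L♯ : (z ⦂ (B ∗ C)) ∈ Γ →
       G3 c n (⟨ var (fresh₁ Γ Δ) , var (fresh₂ Γ Δ) ▷ z ⟩ ∷ (var (fresh₁ Γ Δ) ⦂ B) ∷ (var (fresh₂ Γ Δ) ⦂ C) ∷ Γ)
              Δ →
       G3 c (suc n) Γ Δ
g∗L♯ {Γ = Γ} {Δ = Δ} m = g∗L m (fresh₁≢fresh₂ Γ Δ) (fresh₁-FreshIn Γ Δ) (fresh₂-FreshIn Γ Δ)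

g−∗R♯ : (y ⦂ (B −∗ C)) ∈ Δ →
        G3 c n (⟨ var (fresh₁ Γ Δ) , y ▷ var (fresh₂ Γ Δ) ⟩ ∷ (var (fresh₁ Γ Δ) ⦂ B) ∷ Γ)
               ((var (fresh₂ Γ Δ) ⦂ C) ∷ Δ) →
        G3 c (suc n) Γ Δ
g−∗R♯ {Δ = Δ} {Γ = Γ} m = g−∗R m (fresh₁≢fresh₂ Γ Δ) (fresh₁-FreshIn Γ Δ) (fresh₂-FreshIn Γ Δ)

gA♯ : ⟨ x , y ▷ z ⟩ ∈ Γ → ⟨ u , v ▷ x ⟩ ∈ Γ →
      G3 c n (⟨ u , var (fresh₁ Γ Δ) ▷ z ⟩ ∷ ⟨ y , v ▷ var (fresh₁ Γ Δ) ⟩ ∷ Γ) Δ → G3 c (suc n) Γ Δ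
gA♯ {Γ = Γ} {Δ = Δ} m₁ m₂ = gA m₁ m₂ (fresh₁-FreshIn Γ Δ)

gAC♯ : ⟨ x , y ▷ x ⟩ ∈ Γ →
       G3 c n (⟨ x , var (fresh₁ Γ Δ) ▷ x ⟩ ∷ ⟨ y , y ▷ var (fresh₁ Γ Δ) ⟩ ∷ Γ) Δ → G3 c (suc n) Γ Δ
gAC♯ {Γ = Γ} {Δ = Δ} m = gAC m (fresh₁-FreshIn Γ Δ)

G3-subst : ∀ σ → σ ε ≡ ε → G3 c n Γ Δ → G3 c n (mapL σ Γ) (mapR σ Δ)

∗L-premise-subst : ∀ σ t₁ t₂ → σ ε ≡ ε → ¬ (a ≡ b) → FreshIn a Γ Δ → FreshIn b Γ Δ → z ∈ labelsL Γ →
                   G3 c n (⟨ var a , var b ▷ z ⟩ ∷ (var a ⦂ B) ∷ (var b ⦂ C) ∷ Γ) Δ →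
                   G3 c n (⟨ t₁ , t₂ ▷ σ z ⟩ ∷ (t₁ ⦂ B) ∷ (t₂ ⦂ C) ∷ mapL σ Γ) (mapR σ Δ)
∗L-premise-subst {a = a} {b} {Γ} {Δ} {z} {B = B} {C} σ t₁ t₂ σε a≢b (a∉Γ , a∉Δ) (b∉Γ , b∉Δ) z∈ d =
  castG3 (∗L-eigen σ a b t₁ t₂ a≢b z B C Γ a∉Γ b∉Γ z∈) (update₂-freshʳ σ a b t₁ t₂ a≢b Δ a∉Δ b∉Δ)
    (G3-subst (update (update σ b t₂) a t₁) σε d)

−∗R-premise-subst : ∀ σ t₁ t₂ → σ ε ≡ ε → ¬ (a ≡ b) → FreshIn a Γ Δ → FreshIn b Γ Δ →
                    y ∈ labelsL Γ ⊎ y ∈ labelsR Δ →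
                    G3 c n (⟨ var a , y ▷ var b ⟩ ∷ (var a ⦂ B) ∷ Γ) ((var b ⦂ C) ∷ Δ) →
                    G3 c n (⟨ t₁ , σ y ▷ t₂ ⟩ ∷ (t₁ ⦂ B) ∷ mapL σ Γ) ((t₂ ⦂ C) ∷ mapR σ Δ)
−∗R-premise-subst {a = a} {b} {Γ} {Δ} {y} {B = B} {C} σ t₁ t₂ σε a≢b (a∉Γ , a∉Δ) (b∉Γ , b∉Δ) y∈ d =
  castG3 (−∗R-eigenˡ σ a b t₁ t₂ a≢b y B Γ a∉Γ b∉Γ ([ ∉⇒≢ a∉Γ , ∉⇒≢ a∉Δ ]′ y∈) ([ ∉⇒≢ b∉Γ , ∉⇒≢ b∉Δ ]′ y∈))
         (−∗R-eigenʳ σ a b t₁ t₂ a≢b C Δ a∉Δ b∉Δ)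
    (G3-subst (update (update σ b t₂) a t₁) σε d)

A-premise-subst : ∀ σ t → σ ε ≡ ε → FreshIn a Γ Δ → (∀ {l} → l ∈ (u ∷ z ∷ y ∷ v ∷ []) → l ∈ labelsL Γ) →
                  G3 c n (⟨ u , var a ▷ z ⟩ ∷ ⟨ y , v ▷ var a ⟩ ∷ Γ) Δ →
                  G3 c n (⟨ σ u , t ▷ σ z ⟩ ∷ ⟨ σ y , σ v ▷ t ⟩ ∷ mapL σ Γ) (mapR σ Δ)
A-premise-subst {a = a} {Γ} {Δ} {u} {z} {y} {v} σ t σε (a∉Γ , a∉Δ) labels d =
  castG3 (A-eigen σ a t u z y v Γ a∉Γ labels) (update-freshʳ σ a t Δ a∉Δ) (G3-subst (update σ a t) σε d)

G3-subst σ σε (gid m₁ m₂) = gid (∈-mapL σ m₁) (∈-mapR σ m₂)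
G3-subst σ σε (g⊥L m) = g⊥L (∈-mapL σ m)
G3-subst σ σε (g⊤R m) = g⊤R (∈-mapR σ m)
G3-subst σ σε (g⊤*R m) = g⊤*R (⊤*R-mapR σ σε m)
G3-subst σ σε (gcut e d₁ d₂) = gcut e (G3-subst σ σε d₁) (G3-subst σ σε d₂)
G3-subst {Γ = Γ} {Δ = Δ} σ σε (g⊤*L {w = w} m w≢ε d) with substCaseε σ σε w
... | absorbedε h =
  raise (castG3 (mapL-absorb σ (substL ε w) Γ h) (mapR-absorb σ (substL ε w) Δ h) (G3-subst σ σε d))
... | renamedε σw≢ε h =
  g⊤*L (∈-mapL σ m) σw≢ε
    (castG3 (mapL-∘-absorb t σ _ Γ h) (mapR-∘-absorb t σ _ Δ h)
      (G3-subst (λ l → t (σ l)) (trans (cong t σε) (substL-ε ε (σ w) σw≢ε)) d))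
  where t = substL ε (σ w)
G3-subst σ σε (g∧L m d) = g∧L (∈-mapL σ m) (G3-subst σ σε d)
G3-subst σ σε (g∧R m d₁ d₂) = g∧R (∈-mapR σ m) (G3-subst σ σε d₁) (G3-subst σ σε d₂)
G3-subst σ σε (g⇒L m d₁ d₂) = g⇒L (∈-mapL σ m) (G3-subst σ σε d₁) (G3-subst σ σε d₂)
G3-subst σ σε (g⇒R m d) = g⇒R (∈-mapR σ m) (G3-subst σ σε d)
G3-subst σ σε (g∗L m a≢b fa fb d) =
  g∗L♯ (∈-mapL σ m) (∗L-premise-subst σ _ _ σε a≢b fa fb (∈-labelsL m (here refl)) d)
G3-subst σ σε (g−∗R m a≢b fa fb d) =
  g−∗R♯ (∈-mapR σ m) (−∗R-premise-subst σ _ _ σε a≢b fa fb (inj₂ (∈-labelsR m (here refl))) d)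
G3-subst σ σε (g∗R m₁ m₂ d₁ d₂) = g∗R (∈-mapL σ m₁) (∈-mapR σ m₂) (G3-subst σ σε d₁) (G3-subst σ σε d₂)
G3-subst σ σε (g−∗L m₁ m₂ d₁ d₂) = g−∗L (∈-mapL σ m₁) (∈-mapL σ m₂) (G3-subst σ σε d₁) (G3-subst σ σε d₂)
G3-subst σ σε (gE m d) = gE (∈-mapL σ m) (G3-subst σ σε d)
G3-subst {Γ = Γ} σ σε (gU {x = x} d) =
  gU (castG3 (cong (λ l → ⟨ σ x , l ▷ σ x ⟩ ∷ mapL σ Γ) σε) refl (G3-subst σ σε d))
G3-subst σ σε (gA m₁ m₂ fa d) = gA♯ (∈-mapL σ m₁) (∈-mapL σ m₂) (A-premise-subst σ _ σε fa (A-labels m₁ m₂) d)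
G3-subst σ σε (gAC m fa d) = gAC♯ (∈-mapL σ m) (A-premise-subst σ _ σε fa (A-labels m m) d)
G3-subst {Γ = Γ} {Δ = Δ} σ σε (gEq {w = w} {w' = w'} m w≢ε d) with substCase σ w' w
... | absorbed h =
  raise (castG3 (mapL-absorb σ (substL w' w) Γ h) (mapR-absorb σ (substL w' w) Δ h) (G3-subst σ σε d))
... | renamed {v'} {w''} w''≢ε move h =
  gEq (move (EqAtom-mapL σ σε m)) w''≢ε
    (castG3 (mapL-∘-absorb t σ _ Γ h) (mapR-∘-absorb t σ _ Δ h)
      (G3-subst (λ l → t (σ l)) (trans (cong t σε) (substL-ε v' w'' w''≢ε)) d))
  where t = substL v' w''

∗L-rename : ∀ t₁ t₂ → ¬ (a ≡ b) → FreshIn a Γ Δ → FreshIn b Γ Δ → z ∈ labelsL Γ →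
            G3 c n (⟨ var a , var b ▷ z ⟩ ∷ (var a ⦂ B) ∷ (var b ⦂ C) ∷ Γ) Δ →
            G3 c n (⟨ t₁ , t₂ ▷ z ⟩ ∷ (t₁ ⦂ B) ∷ (t₂ ⦂ C) ∷ Γ) Δ
∗L-rename {Γ = Γ} {Δ = Δ} t₁ t₂ a≢b fa fb z∈ d =
  castG3 (cong (λ Γ' → _ ∷ _ ∷ _ ∷ Γ') (mapL-id Γ)) (mapR-id Δ)
    (∗L-premise-subst (λ l → l) t₁ t₂ refl a≢b fa fb z∈ d)

−∗R-rename : ∀ t₁ t₂ → ¬ (a ≡ b) → FreshIn a Γ Δ → FreshIn b Γ Δ → y ∈ labelsL Γ ⊎ y ∈ labelsR Δ →
             G3 c n (⟨ var a , y ▷ var b ⟩ ∷ (var a ⦂ B) ∷ Γ) ((var b ⦂ C) ∷ Δ) →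
             G3 c n (⟨ t₁ , y ▷ t₂ ⟩ ∷ (t₁ ⦂ B) ∷ Γ) ((t₂ ⦂ C) ∷ Δ)
−∗R-rename {Γ = Γ} {Δ = Δ} t₁ t₂ a≢b fa fb y∈ d =
  castG3 (cong (λ Γ' → _ ∷ _ ∷ Γ') (mapL-id Γ)) (cong (_ ∷_) (mapR-id Δ))
    (−∗R-premise-subst (λ l → l) t₁ t₂ refl a≢b fa fb y∈ d)

A-rename : ∀ t → FreshIn a Γ Δ → (∀ {l} → l ∈ (u ∷ z ∷ y ∷ v ∷ []) → l ∈ labelsL Γ) →
           G3 c n (⟨ u , var a ▷ z ⟩ ∷ ⟨ y , v ▷ var a ⟩ ∷ Γ) Δ →
           G3 c n (⟨ u , t ▷ z ⟩ ∷ ⟨ y , v ▷ t ⟩ ∷ Γ) Δ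
A-rename {Γ = Γ} {Δ = Δ} t fa labels d =
  castG3 (cong (λ Γ' → _ ∷ _ ∷ Γ') (mapL-id Γ)) (mapR-id Δ) (A-premise-subst (λ l → l) t refl fa labels d)

-- Simulations: weakening, contraction and inversion

infixr 9 _⊚_
_⊚_ : ∀ {A : Set} {xs ys zs : List A} → ys ⊆ zs → xs ⊆ ys → xs ⊆ zs
(s ⊚ t) q = s (t q)

⊆-wk : ∀ {A : Set} {xs : List A} {e} → xs ⊆ e ∷ xs
⊆-wk = xs⊆x∷xs _ _

⊆-under : ∀ {A : Set} {xs ys : List A} {e f} → xs ⊆ f ∷ ys → e ∷ xs ⊆ f ∷ e ∷ ys
⊆-under s (here refl) = there (here refl)
⊆-under s (there q) with s q
... | here e = here e
... | there q' = there (there q')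

contract₁ : ∀ {A : Set} {e : A} {xs} → e ∈ xs → e ∷ xs ⊆ xs
contract₁ m = ∈-∷⁺ʳ m ⊆-refl

contract₂ : ∀ {A : Set} {e f : A} {xs} → e ∈ xs → f ∈ xs → e ∷ f ∷ xs ⊆ xs
contract₂ m₁ m₂ = ∈-∷⁺ʳ m₁ (contract₁ m₂)

contract₃ : ∀ {A : Set} {e f g : A} {xs} → e ∈ xs → f ∈ xs → g ∈ xs → e ∷ f ∷ g ∷ xs ⊆ xs
contract₃ m₁ m₂ m₃ = ∈-∷⁺ʳ m₁ (contract₂ m₂ m₃)

∈-∷-split : ∀ {A X : Set} {e f : A} {ys} → e ∈ f ∷ ys → (e ≡ f → X) → e ∈ ys ⊎ X
∈-∷-split (here e) h = inj₂ (h e)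
∈-∷-split (there q) h = inj₁ q

-- The items that no rule of LS removes from its conclusion.
data KeptL : LItem → Set where
  kAtom : ∀ {w p} → KeptL (w ⦂ atom p)
  k⊥    : ∀ {w} → KeptL (w ⦂ ⊥ᶠ)
  kRel  : ∀ {x y z} → KeptL ⟨ x , y ▷ z ⟩
  k−∗   : ∀ {w B C} → KeptL (w ⦂ (B −∗ C))

data KeptR : RItem → Set where
  kAtom : ∀ {w p} → KeptR (w ⦂ atom p)
  k⊤    : ∀ {w} → KeptR (w ⦂ ⊤ᶠ)
  k⊤*   : ∀ {w} → KeptR (w ⦂ ⊤*)
  k∗    : ∀ {w B C} → KeptR (w ⦂ (B ∗ C))

keptL-∈-tail : ∀ {e f : LItem} {ys} → e ∈ f ∷ ys → KeptL e → ¬ (KeptL f) → e ∈ ys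
keptL-∈-tail (here refl) ke ¬kf = ⊥-elim (¬kf ke)
keptL-∈-tail (there q) _ _ = q

keptR-∈-tail : ∀ {e f : RItem} {ys} → e ∈ f ∷ ys → KeptR e → ¬ (KeptR f) → e ∈ ys
keptR-∈-tail (here refl) ke ¬kf = ⊥-elim (¬kf ke)
keptR-∈-tail (there q) _ _ = q

-- A relation R between sequents along which every G3 derivation can be
-- transported with its height: kept items are found in the target, and for
-- every other item the target either contains it or supplies the rule's
-- conclusion from its premises itself.
record Simulation (c : Bool) : Set₁ where
  field
    R : List LItem → List RItem → List LItem → List RItem → Set
    addL : ∀ {Γ Δ Γ' Δ'} e → R Γ Δ Γ' Δ' → R (e ∷ Γ) Δ (e ∷ Γ') Δ'
    addR : ∀ {Γ Δ Γ' Δ'} e → R Γ Δ Γ' Δ' → R Γ (e ∷ Δ) Γ' (e ∷ Δ')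
    relabel : ∀ {Γ Δ Γ' Δ'} v w → ¬ (w ≡ ε) → R Γ Δ Γ' Δ' →
              R (substˡ v w Γ) (substʳ v w Δ) (substˡ v w Γ') (substʳ v w Δ')
    keptL : ∀ {Γ Δ Γ' Δ' e} → R Γ Δ Γ' Δ' → e ∈ Γ → KeptL e → e ∈ Γ'
    keptR : ∀ {Γ Δ Γ' Δ' e} → R Γ Δ Γ' Δ' → e ∈ Δ → KeptR e → e ∈ Δ'
    ⊤*L-step : ∀ {Γ Δ Γ' Δ' n w} → R Γ Δ Γ' Δ' → (w ⦂ ⊤*) ∈ Γ → ¬ (w ≡ ε) →
               (w ⦂ ⊤*) ∈ Γ' ⊎ (G3 c n (substˡ ε w Γ') (substʳ ε w Δ') → G3 c (suc n) Γ' Δ')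
    ∧L-step : ∀ {Γ Δ Γ' Δ' n w B C} → R Γ Δ Γ' Δ' → (w ⦂ (B ∧ C)) ∈ Γ →
              (w ⦂ (B ∧ C)) ∈ Γ' ⊎ (G3 c n ((w ⦂ B) ∷ (w ⦂ C) ∷ Γ') Δ' → G3 c (suc n) Γ' Δ')
    ∧R-step : ∀ {Γ Δ Γ' Δ' n w B C} → R Γ Δ Γ' Δ' → (w ⦂ (B ∧ C)) ∈ Δ →
              (w ⦂ (B ∧ C)) ∈ Δ' ⊎ (G3 c n Γ' ((w ⦂ B) ∷ Δ') → G3 c n Γ' ((w ⦂ C) ∷ Δ') → G3 c (suc n) Γ' Δ')
    ⇒L-step : ∀ {Γ Δ Γ' Δ' n w B C} → R Γ Δ Γ' Δ' → (w ⦂ (B ⇒ C)) ∈ Γ →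
              (w ⦂ (B ⇒ C)) ∈ Γ' ⊎ (G3 c n Γ' ((w ⦂ B) ∷ Δ') → G3 c n ((w ⦂ C) ∷ Γ') Δ' → G3 c (suc n) Γ' Δ')
    ⇒R-step : ∀ {Γ Δ Γ' Δ' n w B C} → R Γ Δ Γ' Δ' → (w ⦂ (B ⇒ C)) ∈ Δ →
              (w ⦂ (B ⇒ C)) ∈ Δ' ⊎ (G3 c n ((w ⦂ B) ∷ Γ') ((w ⦂ C) ∷ Δ') → G3 c (suc n) Γ' Δ')
    ∗L-step : ∀ {Γ Δ Γ' Δ' n z B C a b} → R Γ Δ Γ' Δ' → (z ⦂ (B ∗ C)) ∈ Γ →
              (z ⦂ (B ∗ C)) ∈ Γ' ⊎ (¬ (a ≡ b) → FreshIn a Γ' Δ' → FreshIn b Γ' Δ' →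
                G3 c n (⟨ var a , var b ▷ z ⟩ ∷ (var a ⦂ B) ∷ (var b ⦂ C) ∷ Γ') Δ' → G3 c (suc n) Γ' Δ')
    −∗R-step : ∀ {Γ Δ Γ' Δ' n y B C a b} → R Γ Δ Γ' Δ' → (y ⦂ (B −∗ C)) ∈ Δ →
               (y ⦂ (B −∗ C)) ∈ Δ' ⊎ (¬ (a ≡ b) → FreshIn a Γ' Δ' → FreshIn b Γ' Δ' →
                 G3 c n (⟨ var a , y ▷ var b ⟩ ∷ (var a ⦂ B) ∷ Γ') ((var b ⦂ C) ∷ Δ') → G3 c (suc n) Γ' Δ')

module _ {c : Bool} (S : Simulation c) where
  open Simulation S

  simulate : ∀ n {Γ Δ Γ' Δ'} → G3 c n Γ Δ → R Γ Δ Γ' Δ' → G3 c n Γ' Δ'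
  simulate zero () r
  simulate (suc n) (gid m₁ m₂) r = gid (keptL r m₁ kAtom) (keptR r m₂ kAtom)
  simulate (suc n) (g⊥L m) r = g⊥L (keptL r m k⊥)
  simulate (suc n) (g⊤R m) r = g⊤R (keptR r m k⊤)
  simulate (suc n) (g⊤*R m) r = g⊤*R (keptR r m k⊤*)
  simulate (suc n) (gcut e d₁ d₂) r = gcut e (simulate n d₁ (addR _ r)) (simulate n d₂ (addL _ r))
  simulate (suc n) (g⊤*L {w = w} m w≢ε d) r =
    fromInj₂ (λ m' → g⊤*L m' w≢ε) (⊤*L-step r m w≢ε) (simulate n d (relabel ε w w≢ε r))
  simulate (suc n) (g∧L m d) r = fromInj₂ g∧L (∧L-step r m) (simulate n d (addL _ (addL _ r)))
  simulate (suc n) (g∧R m d₁ d₂) r =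
    fromInj₂ g∧R (∧R-step r m) (simulate n d₁ (addR _ r)) (simulate n d₂ (addR _ r))
  simulate (suc n) (g⇒L m d₁ d₂) r =
    fromInj₂ g⇒L (⇒L-step r m) (simulate n d₁ (addR _ r)) (simulate n d₂ (addL _ r))
  simulate (suc n) (g⇒R m d) r = fromInj₂ g⇒R (⇒R-step r m) (simulate n d (addL _ (addR _ r)))
  simulate (suc n) {Γ' = Γ'} {Δ'} (g∗L m a≢b fa fb d) r =
    fromInj₂ (λ m' → g∗L m') (∗L-step r m) (fresh₁≢fresh₂ Γ' Δ') (fresh₁-FreshIn Γ' Δ') (fresh₂-FreshIn Γ' Δ')
      (simulate n (∗L-rename _ _ a≢b fa fb (∈-labelsL m (here refl)) d) (addL _ (addL _ (addL _ r))))
  simulate (suc n) {Γ' = Γ'} {Δ'} (g−∗R m a≢b fa fb d) r =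
    fromInj₂ (λ m' → g−∗R m') (−∗R-step r m) (fresh₁≢fresh₂ Γ' Δ') (fresh₁-FreshIn Γ' Δ') (fresh₂-FreshIn Γ' Δ')
      (simulate n (−∗R-rename _ _ a≢b fa fb (inj₂ (∈-labelsR m (here refl))) d) (addR _ (addL _ (addL _ r))))
  simulate (suc n) (g∗R m₁ m₂ d₁ d₂) r =
    g∗R (keptL r m₁ kRel) (keptR r m₂ k∗) (simulate n d₁ (addR _ r)) (simulate n d₂ (addR _ r))
  simulate (suc n) (g−∗L m₁ m₂ d₁ d₂) r =
    g−∗L (keptL r m₁ kRel) (keptL r m₂ k−∗) (simulate n d₁ (addR _ r)) (simulate n d₂ (addL _ r))
  simulate (suc n) (gE m d) r = gE (keptL r m kRel) (simulate n d (addL _ r))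
  simulate (suc n) (gU d) r = gU (simulate n d (addL _ r))
  simulate (suc n) (gA m₁ m₂ fa d) r =
    gA♯ (keptL r m₁ kRel) (keptL r m₂ kRel) (simulate n (A-rename _ fa (A-labels m₁ m₂) d) (addL _ (addL _ r)))
  simulate (suc n) (gAC m fa d) r =
    gAC♯ (keptL r m kRel) (simulate n (A-rename _ fa (A-labels m m) d) (addL _ (addL _ r)))
  simulate (suc n) (gEq {w = w} {w' = w'} m w≢ε d) r =
    gEq (⊎-map (λ q → keptL r q kRel) (λ q → keptL r q kRel) m) w≢ε (simulate n d (relabel w' w w≢ε r))

inclusionSim : ∀ {c} → Simulation c
inclusionSim = record
  { R = λ Γ Δ Γ' Δ' → (Γ ⊆ Γ') × (Δ ⊆ Δ')
  ; addL = λ e (s , t) → ∷⁺ʳ _ s , t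
  ; addR = λ e (s , t) → s , ∷⁺ʳ _ t
  ; relabel = λ v w _ (s , t) → ⊆-mapL _ s , ⊆-mapR _ t
  ; keptL = λ (s , t) m _ → s m
  ; keptR = λ (s , t) m _ → t m
  ; ⊤*L-step = λ (s , t) m _ → inj₁ (s m)
  ; ∧L-step = λ (s , t) m → inj₁ (s m)
  ; ∧R-step = λ (s , t) m → inj₁ (t m)
  ; ⇒L-step = λ (s , t) m → inj₁ (s m)
  ; ⇒R-step = λ (s , t) m → inj₁ (t m)
  ; ∗L-step = λ (s , t) m → inj₁ (s m)
  ; −∗R-step = λ (s , t) m → inj₁ (t m)
  }

weaken : G3 c n Γ Δ → Γ ⊆ Γ' → Δ ⊆ Δ' → G3 c n Γ' Δ'
weaken {n = n} d s t = simulate inclusionSim n d (s , t)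

module _ (B C : Form) where

  ∧L-inversion : Simulation c
  ∧L-inversion = record
    { R = λ Γ Δ Γ' Δ' → Σ Label λ w → (Γ ⊆ (w ⦂ (B ∧ C)) ∷ Γ') × (Δ ⊆ Δ') × ((w ⦂ B) ∈ Γ') × ((w ⦂ C) ∈ Γ')
    ; addL = λ e (w , s , t , m₁ , m₂) → w , ⊆-under s , t , there m₁ , there m₂
    ; addR = λ e (w , s , t , m₁ , m₂) → w , s , ∷⁺ʳ _ t , m₁ , m₂
    ; relabel = λ v w' _ (w , s , t , m₁ , m₂) → substL v w' w , ⊆-mapL _ s , ⊆-mapR _ t , ∈-mapL _ m₁ , ∈-mapL _ m₂
    ; keptL = λ (w , s , t , m₁ , m₂) m pe → keptL-∈-tail (s m) pe (λ ())
    ; keptR = λ (w , s , t , m₁ , m₂) m pe → t m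
    ; ⊤*L-step = λ (w , s , t , m₁ , m₂) m _ → ∈-∷-split (s m) (λ ())
    ; ∧L-step = λ (w , s , t , m₁ , m₂) m → ∈-∷-split (s m) (λ { refl d → raise (weaken d (contract₂ m₁ m₂) ⊆-refl) })
    ; ∧R-step = λ (w , s , t , m₁ , m₂) m → inj₁ (t m)
    ; ⇒L-step = λ (w , s , t , m₁ , m₂) m → ∈-∷-split (s m) (λ ())
    ; ⇒R-step = λ (w , s , t , m₁ , m₂) m → inj₁ (t m)
    ; ∗L-step = λ (w , s , t , m₁ , m₂) m → ∈-∷-split (s m) (λ ())
    ; −∗R-step = λ (w , s , t , m₁ , m₂) m → inj₁ (t m)
    }

  -- ⇒L and ∧R are inverted one premise at a time; the disjunct says which.
  ⇒L-inversion : Simulation c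
  ⇒L-inversion = record
    { R = λ Γ Δ Γ' Δ' → Σ Label λ w → (Γ ⊆ (w ⦂ (B ⇒ C)) ∷ Γ') × (Δ ⊆ Δ') × ((w ⦂ B) ∈ Δ' ⊎ (w ⦂ C) ∈ Γ')
    ; addL = λ e (w , s , t , q) → w , ⊆-under s , t , [ inj₁ , (λ q → inj₂ (there q)) ]′ q
    ; addR = λ e (w , s , t , q) → w , s , ∷⁺ʳ _ t , [ (λ q → inj₁ (there q)) , inj₂ ]′ q
    ; relabel = λ v w' _ (w , s , t , q) →
        substL v w' w , ⊆-mapL _ s , ⊆-mapR _ t , [ (λ q → inj₁ (∈-mapR _ q)) , (λ q → inj₂ (∈-mapL _ q)) ]′ q
    ; keptL = λ (w , s , t , q) m pe → keptL-∈-tail (s m) pe (λ ())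
    ; keptR = λ (w , s , t , q) m pe → t m
    ; ⊤*L-step = λ (w , s , t , q) m _ → ∈-∷-split (s m) (λ ())
    ; ∧L-step = λ (w , s , t , q) m → ∈-∷-split (s m) (λ ())
    ; ∧R-step = λ (w , s , t , q) m → inj₁ (t m)
    ; ⇒L-step = λ (w , s , t , q) m → ∈-∷-split (s m) (λ { refl d₁ d₂ →
              [ (λ q₁ → raise (weaken d₁ ⊆-refl (contract₁ q₁))) , (λ q₂ → raise (weaken d₂ (contract₁ q₂) ⊆-refl)) ]′ q })
    ; ⇒R-step = λ (w , s , t , q) m → inj₁ (t m)
    ; ∗L-step = λ (w , s , t , q) m → ∈-∷-split (s m) (λ ())
    ; −∗R-step = λ (w , s , t , q) m → inj₁ (t m)
    }

  ∗L-inversion : Simulation c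
  ∗L-inversion = record
    { R = λ Γ Δ Γ' Δ' → Σ (Label × Label × Label) λ { (z , a , b) → (Γ ⊆ (z ⦂ (B ∗ C)) ∷ Γ') × (Δ ⊆ Δ') ×
            (⟨ a , b ▷ z ⟩ ∈ Γ') × ((a ⦂ B) ∈ Γ') × ((b ⦂ C) ∈ Γ') }
    ; addL = λ e ((z , a , b) , s , t , m₁ , m₂ , m₃) → (z , a , b) , ⊆-under s , t , there m₁ , there m₂ , there m₃
    ; addR = λ e ((z , a , b) , s , t , m₁ , m₂ , m₃) → (z , a , b) , s , ∷⁺ʳ _ t , m₁ , m₂ , m₃
    ; relabel = λ v w' _ ((z , a , b) , s , t , m₁ , m₂ , m₃) →
               (substL v w' z , substL v w' a , substL v w' b) , ⊆-mapL _ s , ⊆-mapR _ t , ∈-mapL _ m₁ , ∈-mapL _ m₂ , ∈-mapL _ m₃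
    ; keptL = λ (_ , s , t , _) m pe → keptL-∈-tail (s m) pe (λ ())
    ; keptR = λ (_ , s , t , _) m pe → t m
    ; ⊤*L-step = λ (_ , s , t , _) m _ → ∈-∷-split (s m) (λ ())
    ; ∧L-step = λ (_ , s , t , _) m → ∈-∷-split (s m) (λ ())
    ; ∧R-step = λ (_ , s , t , _) m → inj₁ (t m)
    ; ⇒L-step = λ (_ , s , t , _) m → ∈-∷-split (s m) (λ ())
    ; ⇒R-step = λ (_ , s , t , _) m → inj₁ (t m)
    ; ∗L-step = λ { ((z , a , b) , s , t , m₁ , m₂ , m₃) m → ∈-∷-split (s m) (λ { refl a≢b fa fb d →
              raise (weaken (∗L-rename a b a≢b fa fb (∈-labelsL m₁ (there (there (here refl)))) d)
                            (contract₃ m₁ m₂ m₃) ⊆-refl) }) }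
    ; −∗R-step = λ (_ , s , t , _) m → inj₁ (t m)
    }

  ∧R-inversion : Simulation c
  ∧R-inversion = record
    { R = λ Γ Δ Γ' Δ' → Σ Label λ w → (Γ ⊆ Γ') × (Δ ⊆ (w ⦂ (B ∧ C)) ∷ Δ') × ((w ⦂ B) ∈ Δ' ⊎ (w ⦂ C) ∈ Δ')
    ; addL = λ e (w , s , t , q) → w , ∷⁺ʳ _ s , t , q
    ; addR = λ e (w , s , t , q) → w , s , ⊆-under t , [ (λ q → inj₁ (there q)) , (λ q → inj₂ (there q)) ]′ q
    ; relabel = λ v w' _ (w , s , t , q) →
        substL v w' w , ⊆-mapL _ s , ⊆-mapR _ t , [ (λ q → inj₁ (∈-mapR _ q)) , (λ q → inj₂ (∈-mapR _ q)) ]′ q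
    ; keptL = λ (w , s , t , q) m pe → s m
    ; keptR = λ (w , s , t , q) m pe → keptR-∈-tail (t m) pe (λ ())
    ; ⊤*L-step = λ (w , s , t , q) m _ → inj₁ (s m)
    ; ∧L-step = λ (w , s , t , q) m → inj₁ (s m)
    ; ∧R-step = λ (w , s , t , q) m → ∈-∷-split (t m) (λ { refl d₁ d₂ →
              [ (λ q₁ → raise (weaken d₁ ⊆-refl (contract₁ q₁))) , (λ q₂ → raise (weaken d₂ ⊆-refl (contract₁ q₂))) ]′ q })
    ; ⇒L-step = λ (w , s , t , q) m → inj₁ (s m)
    ; ⇒R-step = λ (w , s , t , q) m → ∈-∷-split (t m) (λ ())
    ; ∗L-step = λ (w , s , t , q) m → inj₁ (s m)
    ; −∗R-step = λ (w , s , t , q) m → ∈-∷-split (t m) (λ ())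
    }

  ⇒R-inversion : Simulation c
  ⇒R-inversion = record
    { R = λ Γ Δ Γ' Δ' → Σ Label λ w → (Γ ⊆ Γ') × (Δ ⊆ (w ⦂ (B ⇒ C)) ∷ Δ') × ((w ⦂ B) ∈ Γ') × ((w ⦂ C) ∈ Δ')
    ; addL = λ e (w , s , t , m₁ , m₂) → w , ∷⁺ʳ _ s , t , there m₁ , m₂
    ; addR = λ e (w , s , t , m₁ , m₂) → w , s , ⊆-under t , m₁ , there m₂
    ; relabel = λ v w' _ (w , s , t , m₁ , m₂) → substL v w' w , ⊆-mapL _ s , ⊆-mapR _ t , ∈-mapL _ m₁ , ∈-mapR _ m₂
    ; keptL = λ (w , s , t , _) m pe → s m
    ; keptR = λ (w , s , t , _) m pe → keptR-∈-tail (t m) pe (λ ())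
    ; ⊤*L-step = λ (w , s , t , _) m _ → inj₁ (s m)
    ; ∧L-step = λ (w , s , t , _) m → inj₁ (s m)
    ; ∧R-step = λ (w , s , t , _) m → ∈-∷-split (t m) (λ ())
    ; ⇒L-step = λ (w , s , t , _) m → inj₁ (s m)
    ; ⇒R-step = λ (w , s , t , m₁ , m₂) m → ∈-∷-split (t m) (λ { refl d → raise (weaken d (contract₁ m₁) (contract₁ m₂)) })
    ; ∗L-step = λ (w , s , t , _) m → inj₁ (s m)
    ; −∗R-step = λ (w , s , t , _) m → ∈-∷-split (t m) (λ ())
    }

  −∗R-inversion : Simulation c
  −∗R-inversion = record
    { R = λ Γ Δ Γ' Δ' → Σ (Label × Label × Label) λ { (y , a , b) → (Γ ⊆ Γ') × (Δ ⊆ (y ⦂ (B −∗ C)) ∷ Δ') ×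
            (⟨ a , y ▷ b ⟩ ∈ Γ') × ((a ⦂ B) ∈ Γ') × ((b ⦂ C) ∈ Δ') }
    ; addL = λ e ((y , a , b) , s , t , m₁ , m₂ , m₃) → (y , a , b) , ∷⁺ʳ _ s , t , there m₁ , there m₂ , m₃
    ; addR = λ e ((y , a , b) , s , t , m₁ , m₂ , m₃) → (y , a , b) , s , ⊆-under t , m₁ , m₂ , there m₃
    ; relabel = λ v w' _ ((y , a , b) , s , t , m₁ , m₂ , m₃) →
               (substL v w' y , substL v w' a , substL v w' b) , ⊆-mapL _ s , ⊆-mapR _ t , ∈-mapL _ m₁ , ∈-mapL _ m₂ , ∈-mapR _ m₃
    ; keptL = λ (_ , s , t , _) m pe → s m
    ; keptR = λ (_ , s , t , _) m pe → keptR-∈-tail (t m) pe (λ ())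
    ; ⊤*L-step = λ (_ , s , t , _) m _ → inj₁ (s m)
    ; ∧L-step = λ (_ , s , t , _) m → inj₁ (s m)
    ; ∧R-step = λ (_ , s , t , _) m → ∈-∷-split (t m) (λ ())
    ; ⇒L-step = λ (_ , s , t , _) m → inj₁ (s m)
    ; ⇒R-step = λ (_ , s , t , _) m → ∈-∷-split (t m) (λ ())
    ; ∗L-step = λ (_ , s , t , _) m → inj₁ (s m)
    ; −∗R-step = λ { ((y , a , b) , s , t , m₁ , m₂ , m₃) m → ∈-∷-split (t m) (λ { refl a≢b fa fb d →
              raise (weaken (−∗R-rename a b a≢b fa fb (inj₁ (∈-labelsL m₁ (there (here refl)))) d)
                            (contract₂ m₁ m₂) (contract₁ m₃)) }) }
    }

-- Once ⊤*L has substituted ε for w, the copy ε : ⊤* kept by G3 can never be principal again.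
⊤*L-inversion : Simulation c
⊤*L-inversion = record
  { R = λ Γ Δ Γ' Δ' → (Γ ⊆ (ε ⦂ ⊤*) ∷ Γ') × (Δ ⊆ Δ')
  ; addL = λ e (s , t) → ⊆-under s , t
  ; addR = λ e (s , t) → s , ∷⁺ʳ _ t
  ; relabel = λ {Γ} {Δ} {Γ'} {Δ'} v w w≢ε (s , t) →
      subst (λ l → substˡ v w Γ ⊆ (l ⦂ ⊤*) ∷ substˡ v w Γ') (substL-ε v w w≢ε) (⊆-mapL (substL v w) s) , ⊆-mapR _ t
  ; keptL = λ (s , t) m pe → keptL-∈-tail (s m) pe (λ ())
  ; keptR = λ (s , t) m _ → t m
  ; ⊤*L-step = λ (s , t) m w≢ε → ∈-∷-split (s m) (λ { refl → ⊥-elim (w≢ε refl) })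
  ; ∧L-step = λ (s , t) m → ∈-∷-split (s m) (λ ())
  ; ∧R-step = λ (s , t) m → inj₁ (t m)
  ; ⇒L-step = λ (s , t) m → ∈-∷-split (s m) (λ ())
  ; ⇒R-step = λ (s , t) m → inj₁ (t m)
  ; ∗L-step = λ (s , t) m → ∈-∷-split (s m) (λ ())
  ; −∗R-step = λ (s , t) m → inj₁ (t m)
  }



-- Cut elimination in G3

weakenᴰ : Der c Γ Δ → Γ ⊆ Γ' → Δ ⊆ Δ' → Der c Γ' Δ'
weakenᴰ (n , d) s t = n , weaken d s t

⊆-swap : ∀ {A : Set} {e f : A} {xs} → e ∷ f ∷ xs ⊆ f ∷ e ∷ xs
⊆-swap (here refl) = there (here refl)
⊆-swap (there (here refl)) = here refl
⊆-swap (there (there q)) = there (there q)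

⊆-relabelL : ∀ {σ : Label → Label} t → mapL σ Γ ⊆ Γ' → mapL (λ l → t (σ l)) Γ ⊆ mapL t Γ'
⊆-relabelL {Γ = Γ} {σ = σ} t s = ⊆-mapL t s ⊚ ⊆-reflexive (mapL-∘˘ t σ Γ)

⊆-relabelR : ∀ {σ : Label → Label} t → mapR σ Δ ⊆ Δ' → mapR (λ l → t (σ l)) Δ ⊆ mapR t Δ'
⊆-relabelR {Δ = Δ} {σ = σ} t s = ⊆-mapR t s ⊚ ⊆-reflexive (mapR-∘˘ t σ Δ)

rel∈-tail : ∀ {xs a b c l F} → ⟨ a , b ▷ c ⟩ ∈ (l ⦂ F) ∷ xs → ⟨ a , b ▷ c ⟩ ∈ xs
rel∈-tail (there q) = q

-- A cut on x : F whose premises Γ₁ ⊢ Δ₁ and Γ₂ ⊢ Δ₂, relabelled by σ and ρ,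
-- are weakenings of Γ₃ ⊢ x : F, Δ₃ and x : F, Γ₃ ⊢ Δ₃.
CutInto : (σ ρ : Label → Label) → Label → Form →
          List LItem → List RItem → List LItem → List RItem → List LItem → List RItem → Set
CutInto σ ρ x F Γ₁ Δ₁ Γ₂ Δ₂ Γ₃ Δ₃ =
  mapL σ Γ₁ ⊆ Γ₃ → mapR σ Δ₁ ⊆ (x ⦂ F) ∷ Δ₃ → mapL ρ Γ₂ ⊆ (x ⦂ F) ∷ Γ₃ → mapR ρ Δ₂ ⊆ Δ₃ → Der false Γ₃ Δ₃

-- Γ₁ ⊢ Δ₁ can be the left premise of a cut on F, after any relabelling fixing ε.
CutFrom : Form → List LItem → List RItem → Set
CutFrom F Γ₁ Δ₁ = ∀ (σ : Label → Label) → σ ε ≡ ε → ∀ (ρ : Label → Label) → ρ ε ≡ ε →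
  ∀ {n x Γ₂ Δ₂ Γ₃ Δ₃} → G3 false n Γ₂ Δ₂ → CutInto σ ρ x F Γ₁ Δ₁ Γ₂ Δ₂ Γ₃ Δ₃

-- The left premise Γ₁ ⊢ Δ₁ ends with a rule introducing y : F, and the cut
-- is already available for the premises of that rule.
data Principal (Γ₁ : List LItem) (Δ₁ : List RItem) : Form → Label → Set where
  ⊤-principal  : ∀ {y} → Principal Γ₁ Δ₁ ⊤ᶠ y
  ⊤*-principal : Principal Γ₁ Δ₁ ⊤* ε
  ∧-principal  : ∀ {y B C} → CutFrom (B ∧ C) Γ₁ ((y ⦂ B) ∷ Δ₁) → CutFrom (B ∧ C) Γ₁ ((y ⦂ C) ∷ Δ₁) →
                 Principal Γ₁ Δ₁ (B ∧ C) y
  ⇒-principal  : ∀ {y B C} → CutFrom (B ⇒ C) ((y ⦂ B) ∷ Γ₁) ((y ⦂ C) ∷ Δ₁) → Principal Γ₁ Δ₁ (B ⇒ C) y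
  ∗-principal  : ∀ {y y₁ y₂ B C} → ⟨ y₁ , y₂ ▷ y ⟩ ∈ Γ₁ →
                 CutFrom (B ∗ C) Γ₁ ((y₁ ⦂ B) ∷ Δ₁) → CutFrom (B ∗ C) Γ₁ ((y₂ ⦂ C) ∷ Δ₁) → Principal Γ₁ Δ₁ (B ∗ C) y
  −∗-principal : ∀ {y B C} a b → ¬ (a ≡ b) → FreshIn a Γ₁ Δ₁ → FreshIn b Γ₁ Δ₁ → y ∈ labelsR Δ₁ →
                 CutFrom (B −∗ C) (⟨ var a , y ▷ var b ⟩ ∷ (var a ⦂ B) ∷ Γ₁) ((var b ⦂ C) ∷ Δ₁) →
                 Principal Γ₁ Δ₁ (B −∗ C) y

¬Principal-atom : ∀ {Γ₁ Δ₁ p y} → ¬ Principal Γ₁ Δ₁ (atom p) y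
¬Principal-atom ()

¬Principal-⊥ : ∀ {Γ₁ Δ₁ y} → ¬ Principal Γ₁ Δ₁ ⊥ᶠ y
¬Principal-⊥ ()

Principal-⊤*-ε : ∀ {Γ₁ Δ₁ y} → Principal Γ₁ Δ₁ ⊤* y → y ≡ ε
Principal-⊤*-ε ⊤*-principal = refl

-- The right premise ends with ∗L on z : B ∗ C; the cut is available for its premise.
CutOnPremise : Form → List LItem → List RItem → Label → (Label → Label) → List LItem → List RItem → Set
CutOnPremise F Γ₁ Δ₁ y σ Γ₂ Δ₂ =
  ∀ (ρ : Label → Label) → ρ ε ≡ ε → ∀ {x Γ₃ Δ₃} → σ y ≡ x → CutInto σ ρ x F Γ₁ Δ₁ Γ₂ Δ₂ Γ₃ Δ₃

mutual
  cut-admissible : ∀ F {x Γ Δ} → Der false Γ ((x ⦂ F) ∷ Δ) → Der false ((x ⦂ F) ∷ Γ) Δ → Der false Γ Δ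
  cut-admissible F {x} {Γ} {Δ} (_ , d₁) (_ , d₂) =
    cut-left F d₁ (λ l → l) refl (λ l → l) refl d₂
      (⊆-reflexive (mapL-id Γ)) (⊆-reflexive (mapR-id ((x ⦂ F) ∷ Δ)))
      (⊆-reflexive (mapL-id ((x ⦂ F) ∷ Γ))) (⊆-reflexive (mapR-id Δ))

  -- Induction on the left premise until the cut formula is principal in it.
  cut-left : ∀ F {n Γ₁ Δ₁} → G3 false n Γ₁ Δ₁ → CutFrom F Γ₁ Δ₁
  cut-left F (gid m₁ m₂) σ σε ρ ρε d₂ s₁ s₂ s₃ s₄ with s₂ (∈-mapR σ m₂)
  ... | there q = 1 , gid (s₁ (∈-mapL σ m₁)) q
  ... | here refl = _ , weaken (G3-subst ρ ρε d₂) (contract₁ (s₁ (∈-mapL σ m₁)) ⊚ s₃) s₄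
  cut-left F (g⊥L m) σ σε ρ ρε d₂ s₁ s₂ s₃ s₄ = 1 , g⊥L (s₁ (∈-mapL σ m))
  cut-left F (g⊤R m) σ σε ρ ρε d₂ s₁ s₂ s₃ s₄ with s₂ (∈-mapR σ m)
  ... | there q = 1 , g⊤R q
  ... | here refl = cut-right ⊤ᶠ ⊤-principal σ σε ρ ρε d₂ refl s₁ s₂ s₃ s₄
  cut-left F (g⊤*R m) σ σε ρ ρε d₂ s₁ s₂ s₃ s₄ with s₂ (⊤*R-mapR σ σε m)
  ... | there q = 1 , g⊤*R q
  ... | here refl = cut-right ⊤* ⊤*-principal σ σε ρ ρε d₂ σε s₁ s₂ s₃ s₄
  cut-left F (gcut () _ _) σ σε ρ ρε d₂ s₁ s₂ s₃ s₄
  cut-left F {Γ₁ = Γ₁} {Δ₁} (g⊤*L {w = w} m w≢ε d) σ σε ρ ρε d₂ s₁ s₂ s₃ s₄ with substCaseε σ σε w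
  ... | absorbedε h =
    cut-left F d σ σε ρ ρε d₂ (s₁ ⊚ ⊆-reflexive (mapL-absorb σ _ Γ₁ h)) (s₂ ⊚ ⊆-reflexive (mapR-absorb σ _ Δ₁ h)) s₃ s₄
  ... | renamedε σw≢ε h =
    rule₁ (g⊤*L (s₁ (∈-mapL σ m)) σw≢ε)
      (cut-left F d (λ l → t (σ l)) (trans (cong t σε) tε) (λ l → t (ρ l)) (trans (cong t ρε) tε) d₂
        (⊆-relabelL t s₁ ⊚ ⊆-reflexive (mapL-absorb _ _ Γ₁ h)) (⊆-relabelR t s₂ ⊚ ⊆-reflexive (mapR-absorb _ _ Δ₁ h))
        (⊆-relabelL t s₃) (⊆-relabelR t s₄))
    where
    t = substL ε (σ w)
    tε = substL-ε ε (σ w) σw≢ε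
  cut-left F (g∧L m d) σ σε ρ ρε d₂ s₁ s₂ s₃ s₄ =
    rule₁ (g∧L (s₁ (∈-mapL σ m))) (cut-left F d σ σε ρ ρε d₂ (∷⁺ʳ _ (∷⁺ʳ _ s₁)) s₂ (∷⁺ʳ _ (⊆-wk ⊚ ⊆-wk) ⊚ s₃) s₄)
  cut-left F (g∧R m d d') σ σε ρ ρε d₂ s₁ s₂ s₃ s₄ with s₂ (∈-mapR σ m)
  ... | there q = rule₂ (g∧R q) (cut-left F d σ σε ρ ρε d₂ s₁ (⊆-under s₂) s₃ (⊆-wk ⊚ s₄))
                                (cut-left F d' σ σε ρ ρε d₂ s₁ (⊆-under s₂) s₃ (⊆-wk ⊚ s₄))
  ... | here refl = cut-right _ (∧-principal (cut-left _ d) (cut-left _ d')) σ σε ρ ρε d₂ refl s₁ s₂ s₃ s₄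
  cut-left F (g⇒L m d d') σ σε ρ ρε d₂ s₁ s₂ s₃ s₄ =
    rule₂ (g⇒L (s₁ (∈-mapL σ m))) (cut-left F d σ σε ρ ρε d₂ s₁ (⊆-under s₂) s₃ (⊆-wk ⊚ s₄))
                                  (cut-left F d' σ σε ρ ρε d₂ (∷⁺ʳ _ s₁) s₂ (∷⁺ʳ _ ⊆-wk ⊚ s₃) s₄)
  cut-left F (g⇒R m d) σ σε ρ ρε d₂ s₁ s₂ s₃ s₄ with s₂ (∈-mapR σ m)
  ... | there q = rule₁ (g⇒R q) (cut-left F d σ σε ρ ρε d₂ (∷⁺ʳ _ s₁) (⊆-under s₂) (∷⁺ʳ _ ⊆-wk ⊚ s₃) (⊆-wk ⊚ s₄))
  ... | here refl = cut-right _ (⇒-principal (cut-left _ d)) σ σε ρ ρε d₂ refl s₁ s₂ s₃ s₄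
  cut-left F {Γ₁ = Γ₁} {Δ₁} (g∗L {z = z} {B = B} {C = C} {a = a} {b = b} m a≢b (a∉Γ₁ , a∉Δ₁) (b∉Γ₁ , b∉Δ₁) d)
      σ σε ρ ρε {Γ₃ = Γ₃} {Δ₃} d₂ s₁ s₂ s₃ s₄ =
    rule₁ (g∗L♯ (s₁ (∈-mapL σ m)))
      (cut-left F d (update (update σ b t₂) a t₁) σε ρ ρε d₂
        (∷⁺ʳ _ (∷⁺ʳ _ (∷⁺ʳ _ s₁)) ⊚ ⊆-reflexive (∗L-eigen σ a b t₁ t₂ a≢b z B C Γ₁ a∉Γ₁ b∉Γ₁ (∈-labelsL m (here refl))))
        (s₂ ⊚ ⊆-reflexive (update₂-freshʳ σ a b t₁ t₂ a≢b Δ₁ a∉Δ₁ b∉Δ₁))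
        (∷⁺ʳ _ (⊆-wk ⊚ ⊆-wk ⊚ ⊆-wk) ⊚ s₃) s₄)
    where
    t₁ = var (fresh₁ Γ₃ Δ₃)
    t₂ = var (fresh₂ Γ₃ Δ₃)
  cut-left F {Γ₁ = Γ₁} {Δ₁} (g−∗R {y = y} {B = B} {C = C} {a = a} {b = b} m a≢b fa@(a∉Γ₁ , a∉Δ₁) fb@(b∉Γ₁ , b∉Δ₁) d)
      σ σε ρ ρε {Γ₃ = Γ₃} {Δ₃} d₂ s₁ s₂ s₃ s₄ with s₂ (∈-mapR σ m)
  ... | there q =
    rule₁ (g−∗R♯ q)
      (cut-left F d (update (update σ b t₂) a t₁) σε ρ ρε d₂
        (∷⁺ʳ _ (∷⁺ʳ _ s₁) ⊚ ⊆-reflexive (−∗R-eigenˡ σ a b t₁ t₂ a≢b y B Γ₁ a∉Γ₁ b∉Γ₁ (∉⇒≢ a∉Δ₁ y∈) (∉⇒≢ b∉Δ₁ y∈)))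
        (⊆-under s₂ ⊚ ⊆-reflexive (−∗R-eigenʳ σ a b t₁ t₂ a≢b C Δ₁ a∉Δ₁ b∉Δ₁))
        (∷⁺ʳ _ (⊆-wk ⊚ ⊆-wk) ⊚ s₃) (⊆-wk ⊚ s₄))
    where
    t₁ = var (fresh₁ Γ₃ Δ₃)
    t₂ = var (fresh₂ Γ₃ Δ₃)
    y∈ = ∈-labelsR m (here refl)
  ... | here refl =
    cut-right _ (−∗-principal a b a≢b fa fb (∈-labelsR m (here refl)) (cut-left _ d)) σ σε ρ ρε d₂ refl s₁ s₂ s₃ s₄
  cut-left F (g∗R m₁ m₂ d d') σ σε ρ ρε d₂ s₁ s₂ s₃ s₄ with s₂ (∈-mapR σ m₂)
  ... | there q = rule₂ (g∗R (s₁ (∈-mapL σ m₁)) q) (cut-left F d σ σε ρ ρε d₂ s₁ (⊆-under s₂) s₃ (⊆-wk ⊚ s₄))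
                                                  (cut-left F d' σ σε ρ ρε d₂ s₁ (⊆-under s₂) s₃ (⊆-wk ⊚ s₄))
  ... | here refl = cut-right _ (∗-principal m₁ (cut-left _ d) (cut-left _ d')) σ σε ρ ρε d₂ refl s₁ s₂ s₃ s₄
  cut-left F (g−∗L m₁ m₂ d d') σ σε ρ ρε d₂ s₁ s₂ s₃ s₄ =
    rule₂ (g−∗L (s₁ (∈-mapL σ m₁)) (s₁ (∈-mapL σ m₂))) (cut-left F d σ σε ρ ρε d₂ s₁ (⊆-under s₂) s₃ (⊆-wk ⊚ s₄))
                                                        (cut-left F d' σ σε ρ ρε d₂ (∷⁺ʳ _ s₁) s₂ (∷⁺ʳ _ ⊆-wk ⊚ s₃) s₄)
  cut-left F (gE m d) σ σε ρ ρε d₂ s₁ s₂ s₃ s₄ =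
    rule₁ (gE (s₁ (∈-mapL σ m))) (cut-left F d σ σε ρ ρε d₂ (∷⁺ʳ _ s₁) s₂ (∷⁺ʳ _ ⊆-wk ⊚ s₃) s₄)
  cut-left F {Γ₁ = Γ₁} (gU {x = u} d) σ σε ρ ρε d₂ s₁ s₂ s₃ s₄ =
    rule₁ (gU {x = σ u})
      (cut-left F d σ σε ρ ρε d₂ (∷⁺ʳ _ s₁ ⊚ ⊆-reflexive (cong (λ l → ⟨ σ u , l ▷ σ u ⟩ ∷ mapL σ Γ₁) σε)) s₂
        (∷⁺ʳ _ ⊆-wk ⊚ s₃) s₄)
  cut-left F {Γ₁ = Γ₁} {Δ₁} (gA {y = y} {z = z} {u = u} {v = v} {a = a} m₁ m₂ (a∉Γ₁ , a∉Δ₁) d)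
      σ σε ρ ρε {Γ₃ = Γ₃} {Δ₃} d₂ s₁ s₂ s₃ s₄ =
    rule₁ (gA♯ (s₁ (∈-mapL σ m₁)) (s₁ (∈-mapL σ m₂)))
      (cut-left F d (update σ a t) σε ρ ρε d₂
        (∷⁺ʳ _ (∷⁺ʳ _ s₁) ⊚ ⊆-reflexive (A-eigen σ a t u z y v Γ₁ a∉Γ₁ (A-labels m₁ m₂)))
        (s₂ ⊚ ⊆-reflexive (update-freshʳ σ a t Δ₁ a∉Δ₁)) (∷⁺ʳ _ (⊆-wk ⊚ ⊆-wk) ⊚ s₃) s₄)
    where t = var (fresh₁ Γ₃ Δ₃)
  cut-left F {Γ₁ = Γ₁} {Δ₁} (gAC {x = x} {y = y} {a = a} m (a∉Γ₁ , a∉Δ₁) d)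
      σ σε ρ ρε {Γ₃ = Γ₃} {Δ₃} d₂ s₁ s₂ s₃ s₄ =
    rule₁ (gAC♯ (s₁ (∈-mapL σ m)))
      (cut-left F d (update σ a t) σε ρ ρε d₂
        (∷⁺ʳ _ (∷⁺ʳ _ s₁) ⊚ ⊆-reflexive (A-eigen σ a t x x y y Γ₁ a∉Γ₁ (A-labels m m)))
        (s₂ ⊚ ⊆-reflexive (update-freshʳ σ a t Δ₁ a∉Δ₁)) (∷⁺ʳ _ (⊆-wk ⊚ ⊆-wk) ⊚ s₃) s₄)
    where t = var (fresh₁ Γ₃ Δ₃)
  cut-left F {Γ₁ = Γ₁} {Δ₁} (gEq {w = w} {w' = w'} m w≢ε d) σ σε ρ ρε d₂ s₁ s₂ s₃ s₄ with substCase σ w' w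
  ... | absorbed h =
    cut-left F d σ σε ρ ρε d₂ (s₁ ⊚ ⊆-reflexive (mapL-absorb σ _ Γ₁ h)) (s₂ ⊚ ⊆-reflexive (mapR-absorb σ _ Δ₁ h)) s₃ s₄
  ... | renamed {v'} {w''} w''≢ε move h =
    rule₁ (gEq (move (⊎-map s₁ s₁ (EqAtom-mapL σ σε m))) w''≢ε)
      (cut-left F d (λ l → t (σ l)) (trans (cong t σε) tε) (λ l → t (ρ l)) (trans (cong t ρε) tε) d₂
        (⊆-relabelL t s₁ ⊚ ⊆-reflexive (mapL-absorb _ _ Γ₁ h)) (⊆-relabelR t s₂ ⊚ ⊆-reflexive (mapR-absorb _ _ Δ₁ h))
        (⊆-relabelL t s₃) (⊆-relabelR t s₄))
    where
    t = substL v' w''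
    tε = substL-ε v' w'' w''≢ε

  -- Induction on the right premise, the cut formula being principal on the left.
  cut-right : ∀ F {Γ₁ Δ₁ y} → Principal Γ₁ Δ₁ F y → ∀ σ → σ ε ≡ ε → ∀ ρ → ρ ε ≡ ε →
              ∀ {n x Γ₂ Δ₂ Γ₃ Δ₃} → G3 false n Γ₂ Δ₂ → σ y ≡ x → CutInto σ ρ x F Γ₁ Δ₁ Γ₂ Δ₂ Γ₃ Δ₃
  cut-right F pr σ σε ρ ρε (gid m₁ m₂) e s₁ s₂ s₃ s₄ with s₃ (∈-mapL ρ m₁)
  ... | there q = 1 , gid q (s₄ (∈-mapR ρ m₂))
  ... | here refl = ⊥-elim (¬Principal-atom pr)
  cut-right F pr σ σε ρ ρε (g⊥L m) e s₁ s₂ s₃ s₄ with s₃ (∈-mapL ρ m)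
  ... | there q = 1 , g⊥L q
  ... | here refl = ⊥-elim (¬Principal-⊥ pr)
  cut-right F pr σ σε ρ ρε (g⊤R m) e s₁ s₂ s₃ s₄ = 1 , g⊤R (s₄ (∈-mapR ρ m))
  cut-right F pr σ σε ρ ρε (g⊤*R m) e s₁ s₂ s₃ s₄ = 1 , g⊤*R (s₄ (⊤*R-mapR ρ ρε m))
  cut-right F pr σ σε ρ ρε (gcut () _ _) e s₁ s₂ s₃ s₄
  cut-right F {Γ₁} {Δ₁} pr σ σε ρ ρε {Γ₂ = Γ₂} {Δ₂} (g⊤*L {w = w} m w≢ε d) e s₁ s₂ s₃ s₄ with substCaseε ρ ρε w
  ... | absorbedε h =
    cut-right F pr σ σε ρ ρε d e s₁ s₂ (s₃ ⊚ ⊆-reflexive (mapL-absorb ρ _ Γ₂ h)) (s₄ ⊚ ⊆-reflexive (mapR-absorb ρ _ Δ₂ h))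
  ... | renamedε ρw≢ε h with s₃ (∈-mapL ρ m)
  ...   | here refl = ⊥-elim (ρw≢ε (trans (sym e) (trans (cong σ (Principal-⊤*-ε pr)) σε)))
  ...   | there q =
    rule₁ (g⊤*L q ρw≢ε)
      (cut-right F pr (λ l → t (σ l)) (trans (cong t σε) tε) (λ l → t (ρ l)) (trans (cong t ρε) tε) d (cong t e)
        (⊆-relabelL t s₁) (⊆-relabelR t s₂)
        (⊆-relabelL t s₃ ⊚ ⊆-reflexive (mapL-absorb _ _ Γ₂ h)) (⊆-relabelR t s₄ ⊚ ⊆-reflexive (mapR-absorb _ _ Δ₂ h)))
    where
    t = substL ε (ρ w)
    tε = substL-ε ε (ρ w) ρw≢ε
  cut-right F pr σ σε ρ ρε d₂@(g∧L m d) e s₁ s₂ s₃ s₄ with s₃ (∈-mapL ρ m)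
  ... | there q = rule₁ (g∧L q) (cut-right F pr σ σε ρ ρε d e (⊆-wk ⊚ ⊆-wk ⊚ s₁) s₂ (⊆-under (⊆-under s₃)) s₄)
  ... | here refl =
    cut-∧ _ _ pr σ σε ρ ρε d₂ e (cut-right _ pr σ σε ρ ρε d e (⊆-wk ⊚ ⊆-wk ⊚ s₁) s₂ (⊆-under (⊆-under s₃)) s₄)
      s₁ s₂ s₃ s₄
  cut-right F pr σ σε ρ ρε (g∧R m d d') e s₁ s₂ s₃ s₄ =
    rule₂ (g∧R (s₄ (∈-mapR ρ m))) (cut-right F pr σ σε ρ ρε d e s₁ (∷⁺ʳ _ ⊆-wk ⊚ s₂) s₃ (∷⁺ʳ _ s₄))
                                  (cut-right F pr σ σε ρ ρε d' e s₁ (∷⁺ʳ _ ⊆-wk ⊚ s₂) s₃ (∷⁺ʳ _ s₄))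
  cut-right F pr σ σε ρ ρε d₂@(g⇒L m d d') e s₁ s₂ s₃ s₄ with s₃ (∈-mapL ρ m)
  ... | there q =
    rule₂ (g⇒L q) (cut-right F pr σ σε ρ ρε d e s₁ (∷⁺ʳ _ ⊆-wk ⊚ s₂) s₃ (∷⁺ʳ _ s₄))
                  (cut-right F pr σ σε ρ ρε d' e (⊆-wk ⊚ s₁) s₂ (⊆-under s₃) s₄)
  ... | here refl =
    cut-⇒ _ _ pr σ σε ρ ρε d₂ e (cut-right _ pr σ σε ρ ρε d e s₁ (∷⁺ʳ _ ⊆-wk ⊚ s₂) s₃ (∷⁺ʳ _ s₄))
                                (cut-right _ pr σ σε ρ ρε d' e (⊆-wk ⊚ s₁) s₂ (⊆-under s₃) s₄) s₁ s₂ s₃ s₄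
  cut-right F pr σ σε ρ ρε (g⇒R m d) e s₁ s₂ s₃ s₄ =
    rule₁ (g⇒R (s₄ (∈-mapR ρ m))) (cut-right F pr σ σε ρ ρε d e (⊆-wk ⊚ s₁) (∷⁺ʳ _ ⊆-wk ⊚ s₂) (⊆-under s₃) (∷⁺ʳ _ s₄))
  cut-right F pr σ σε ρ ρε {Γ₂ = Γ₂} {Δ₂} {Γ₃} {Δ₃}
      d₂@(g∗L {z = z} {B = B} {C = C} {a = a} {b = b} m a≢b fa@(a∉Γ₂ , a∉Δ₂) fb@(b∉Γ₂ , b∉Δ₂) d) e s₁ s₂ s₃ s₄
      with s₃ (∈-mapL ρ m)
  ... | there q =
    rule₁ (g∗L♯ q)
      (cut-right F pr σ σε (update (update ρ b t₂) a t₁) ρε d e (⊆-wk ⊚ ⊆-wk ⊚ ⊆-wk ⊚ s₁) s₂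
        (⊆-under (⊆-under (⊆-under s₃)) ⊚ ⊆-reflexive (∗L-eigen ρ a b t₁ t₂ a≢b z B C Γ₂ a∉Γ₂ b∉Γ₂ (∈-labelsL m (here refl))))
        (s₄ ⊚ ⊆-reflexive (update₂-freshʳ ρ a b t₁ t₂ a≢b Δ₂ a∉Δ₂ b∉Δ₂)))
    where
    t₁ = var (fresh₁ Γ₃ Δ₃)
    t₂ = var (fresh₂ Γ₃ Δ₃)
  ... | here refl =
    cut-∗ _ _ pr σ σε ρ ρε d₂ e (∈-labelsL m (here refl)) a≢b fa fb
      (λ ρ' ρ'ε e' → cut-right _ pr σ σε ρ' ρ'ε d e') s₁ s₂ s₃ s₄
  cut-right F pr σ σε ρ ρε {Γ₂ = Γ₂} {Δ₂} {Γ₃} {Δ₃}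
      (g−∗R {y = y} {B = B} {C = C} {a = a} {b = b} m a≢b (a∉Γ₂ , a∉Δ₂) (b∉Γ₂ , b∉Δ₂) d) e s₁ s₂ s₃ s₄ =
    rule₁ (g−∗R♯ (s₄ (∈-mapR ρ m)))
      (cut-right F pr σ σε (update (update ρ b t₂) a t₁) ρε d e (⊆-wk ⊚ ⊆-wk ⊚ s₁) (∷⁺ʳ _ ⊆-wk ⊚ s₂)
        (⊆-under (⊆-under s₃) ⊚ ⊆-reflexive (−∗R-eigenˡ ρ a b t₁ t₂ a≢b y B Γ₂ a∉Γ₂ b∉Γ₂ (∉⇒≢ a∉Δ₂ y∈) (∉⇒≢ b∉Δ₂ y∈)))
        (∷⁺ʳ _ s₄ ⊚ ⊆-reflexive (−∗R-eigenʳ ρ a b t₁ t₂ a≢b C Δ₂ a∉Δ₂ b∉Δ₂)))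
    where
    t₁ = var (fresh₁ Γ₃ Δ₃)
    t₂ = var (fresh₂ Γ₃ Δ₃)
    y∈ = ∈-labelsR m (here refl)
  cut-right F pr σ σε ρ ρε (g∗R m₁ m₂ d d') e s₁ s₂ s₃ s₄ =
    rule₂ (g∗R (rel∈-tail (s₃ (∈-mapL ρ m₁))) (s₄ (∈-mapR ρ m₂)))
      (cut-right F pr σ σε ρ ρε d e s₁ (∷⁺ʳ _ ⊆-wk ⊚ s₂) s₃ (∷⁺ʳ _ s₄))
      (cut-right F pr σ σε ρ ρε d' e s₁ (∷⁺ʳ _ ⊆-wk ⊚ s₂) s₃ (∷⁺ʳ _ s₄))
  cut-right F pr σ σε ρ ρε d₂@(g−∗L m₁ m₂ d d') e s₁ s₂ s₃ s₄ with s₃ (∈-mapL ρ m₂)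
  ... | there q =
    rule₂ (g−∗L (rel∈-tail (s₃ (∈-mapL ρ m₁))) q)
      (cut-right F pr σ σε ρ ρε d e s₁ (∷⁺ʳ _ ⊆-wk ⊚ s₂) s₃ (∷⁺ʳ _ s₄))
      (cut-right F pr σ σε ρ ρε d' e (⊆-wk ⊚ s₁) s₂ (⊆-under s₃) s₄)
  ... | here refl =
    cut-−∗ _ _ pr σ σε ρ ρε d₂ e (rel∈-tail (s₃ (∈-mapL ρ m₁)))
      (cut-right _ pr σ σε ρ ρε d e s₁ (∷⁺ʳ _ ⊆-wk ⊚ s₂) s₃ (∷⁺ʳ _ s₄))
      (cut-right _ pr σ σε ρ ρε d' e (⊆-wk ⊚ s₁) s₂ (⊆-under s₃) s₄) s₁ s₂ s₃ s₄
  cut-right F pr σ σε ρ ρε (gE m d) e s₁ s₂ s₃ s₄ =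
    rule₁ (gE (rel∈-tail (s₃ (∈-mapL ρ m)))) (cut-right F pr σ σε ρ ρε d e (⊆-wk ⊚ s₁) s₂ (⊆-under s₃) s₄)
  cut-right F pr σ σε ρ ρε {Γ₂ = Γ₂} (gU {x = u} d) e s₁ s₂ s₃ s₄ =
    rule₁ (gU {x = ρ u})
      (cut-right F pr σ σε ρ ρε d e (⊆-wk ⊚ s₁) s₂
        (⊆-under s₃ ⊚ ⊆-reflexive (cong (λ l → ⟨ ρ u , l ▷ ρ u ⟩ ∷ mapL ρ Γ₂) ρε)) s₄)
  cut-right F pr σ σε ρ ρε {Γ₂ = Γ₂} {Δ₂} {Γ₃} {Δ₃}
      (gA {y = y} {z = z} {u = u} {v = v} {a = a} m₁ m₂ (a∉Γ₂ , a∉Δ₂) d) e s₁ s₂ s₃ s₄ =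
    rule₁ (gA♯ (rel∈-tail (s₃ (∈-mapL ρ m₁))) (rel∈-tail (s₃ (∈-mapL ρ m₂))))
      (cut-right F pr σ σε (update ρ a t) ρε d e (⊆-wk ⊚ ⊆-wk ⊚ s₁) s₂
        (⊆-under (⊆-under s₃) ⊚ ⊆-reflexive (A-eigen ρ a t u z y v Γ₂ a∉Γ₂ (A-labels m₁ m₂)))
        (s₄ ⊚ ⊆-reflexive (update-freshʳ ρ a t Δ₂ a∉Δ₂)))
    where t = var (fresh₁ Γ₃ Δ₃)
  cut-right F pr σ σε ρ ρε {Γ₂ = Γ₂} {Δ₂} {Γ₃} {Δ₃} (gAC {x = x} {y = y} {a = a} m (a∉Γ₂ , a∉Δ₂) d) e s₁ s₂ s₃ s₄ =
    rule₁ (gAC♯ (rel∈-tail (s₃ (∈-mapL ρ m))))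
      (cut-right F pr σ σε (update ρ a t) ρε d e (⊆-wk ⊚ ⊆-wk ⊚ s₁) s₂
        (⊆-under (⊆-under s₃) ⊚ ⊆-reflexive (A-eigen ρ a t x x y y Γ₂ a∉Γ₂ (A-labels m m)))
        (s₄ ⊚ ⊆-reflexive (update-freshʳ ρ a t Δ₂ a∉Δ₂)))
    where t = var (fresh₁ Γ₃ Δ₃)
  cut-right F pr σ σε ρ ρε {Γ₂ = Γ₂} {Δ₂} (gEq {w = w} {w' = w'} m w≢ε d) e s₁ s₂ s₃ s₄ with substCase ρ w' w
  ... | absorbed h =
    cut-right F pr σ σε ρ ρε d e s₁ s₂ (s₃ ⊚ ⊆-reflexive (mapL-absorb ρ _ Γ₂ h)) (s₄ ⊚ ⊆-reflexive (mapR-absorb ρ _ Δ₂ h))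
  ... | renamed {v'} {w''} w''≢ε move h =
    rule₁ (gEq (move (⊎-map (λ q → rel∈-tail (s₃ q)) (λ q → rel∈-tail (s₃ q)) (EqAtom-mapL ρ ρε m))) w''≢ε)
      (cut-right F pr (λ l → t (σ l)) (trans (cong t σε) tε) (λ l → t (ρ l)) (trans (cong t ρε) tε) d (cong t e)
        (⊆-relabelL t s₁) (⊆-relabelR t s₂)
        (⊆-relabelL t s₃ ⊚ ⊆-reflexive (mapL-absorb _ _ Γ₂ h)) (⊆-relabelR t s₄ ⊚ ⊆-reflexive (mapR-absorb _ _ Δ₂ h)))
    where
    t = substL v' w''
    tε = substL-ε v' w'' w''≢ε

  cut-∧ : ∀ B C {Γ₁ Δ₁ y} → Principal Γ₁ Δ₁ (B ∧ C) y → ∀ σ → σ ε ≡ ε → ∀ ρ → ρ ε ≡ ε →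
          ∀ {n x Γ₂ Δ₂ Γ₃ Δ₃} → G3 false n Γ₂ Δ₂ → σ y ≡ x → Der false ((x ⦂ B) ∷ (x ⦂ C) ∷ Γ₃) Δ₃ →
          CutInto σ ρ x (B ∧ C) Γ₁ Δ₁ Γ₂ Δ₂ Γ₃ Δ₃
  cut-∧ B C (∧-principal f g) σ σε ρ ρε d₂ refl r s₁ s₂ s₃ s₄ =
    cut-admissible B (f σ σε ρ ρε d₂ s₁ (⊆-under s₂) s₃ (⊆-wk ⊚ s₄))
      (cut-admissible C (weakenᴰ (g σ σε ρ ρε d₂ s₁ (⊆-under s₂) s₃ (⊆-wk ⊚ s₄)) ⊆-wk ⊆-refl) (weakenᴰ r ⊆-swap ⊆-refl))

  cut-⇒ : ∀ B C {Γ₁ Δ₁ y} → Principal Γ₁ Δ₁ (B ⇒ C) y → ∀ σ → σ ε ≡ ε → ∀ ρ → ρ ε ≡ ε →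
          ∀ {n x Γ₂ Δ₂ Γ₃ Δ₃} → G3 false n Γ₂ Δ₂ → σ y ≡ x →
          Der false Γ₃ ((x ⦂ B) ∷ Δ₃) → Der false ((x ⦂ C) ∷ Γ₃) Δ₃ →
          CutInto σ ρ x (B ⇒ C) Γ₁ Δ₁ Γ₂ Δ₂ Γ₃ Δ₃
  cut-⇒ B C (⇒-principal f) σ σε ρ ρε d₂ refl r₁ r₂ s₁ s₂ s₃ s₄ =
    cut-admissible C
      (cut-admissible B (weakenᴰ r₁ ⊆-refl (∷⁺ʳ _ ⊆-wk))
        (f σ σε ρ ρε d₂ (∷⁺ʳ _ s₁) (⊆-under s₂) (∷⁺ʳ _ ⊆-wk ⊚ s₃) (⊆-wk ⊚ s₄)))
      r₂

  -- The eigenvariables of the right ∗L are instantiated by the labels of the left ∗R.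
  cut-∗ : ∀ B C {Γ₁ Δ₁ y} → Principal Γ₁ Δ₁ (B ∗ C) y → ∀ σ → σ ε ≡ ε → ∀ ρ → ρ ε ≡ ε →
          ∀ {n z a b Γ₂ Δ₂ Γ₃ Δ₃} → G3 false n Γ₂ Δ₂ → σ y ≡ ρ z → z ∈ labelsL Γ₂ →
          ¬ (a ≡ b) → FreshIn a Γ₂ Δ₂ → FreshIn b Γ₂ Δ₂ →
          CutOnPremise (B ∗ C) Γ₁ Δ₁ y σ (⟨ var a , var b ▷ z ⟩ ∷ (var a ⦂ B) ∷ (var b ⦂ C) ∷ Γ₂) Δ₂ →
          CutInto σ ρ (ρ z) (B ∗ C) Γ₁ Δ₁ Γ₂ Δ₂ Γ₃ Δ₃
  cut-∗ B C (∗-principal {y₁ = y₁} {y₂} m f g) σ σε ρ ρε {z = z} {a} {b} {Γ₂} {Δ₂} {Γ₃} {Δ₃}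
      d₂ e z∈ a≢b (a∉Γ₂ , a∉Δ₂) (b∉Γ₂ , b∉Δ₂) cut-premise s₁ s₂ s₃ s₄ =
    cut-admissible B (f σ σε ρ ρε d₂ s₁ (⊆-under s₂) s₃ (⊆-wk ⊚ s₄))
      (cut-admissible C (weakenᴰ (g σ σε ρ ρε d₂ s₁ (⊆-under s₂) s₃ (⊆-wk ⊚ s₄)) ⊆-wk ⊆-refl)
        (weakenᴰ instantiated ⊆-swap ⊆-refl))
    where
    rel∈Γ₃ : ⟨ σ y₁ , σ y₂ ▷ ρ z ⟩ ∈ Γ₃
    rel∈Γ₃ = subst (λ l → ⟨ σ y₁ , σ y₂ ▷ l ⟩ ∈ Γ₃) e (s₁ (∈-mapL σ m))
    instantiated : Der false ((σ y₁ ⦂ B) ∷ (σ y₂ ⦂ C) ∷ Γ₃) Δ₃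
    instantiated =
      cut-premise (update (update ρ b (σ y₂)) a (σ y₁)) ρε e (⊆-wk ⊚ ⊆-wk ⊚ s₁) s₂
        (∈-∷⁺ʳ (there (there (there rel∈Γ₃))) (⊆-under (⊆-under s₃))
          ⊚ ⊆-reflexive (∗L-eigen ρ a b (σ y₁) (σ y₂) a≢b z B C Γ₂ a∉Γ₂ b∉Γ₂ z∈))
        (s₄ ⊚ ⊆-reflexive (update₂-freshʳ ρ a b (σ y₁) (σ y₂) a≢b Δ₂ a∉Δ₂ b∉Δ₂))

  -- The eigenvariables of the left −∗R are instantiated by the labels of the right −∗L.
  cut-−∗ : ∀ B C {Γ₁ Δ₁ y} → Principal Γ₁ Δ₁ (B −∗ C) y → ∀ σ → σ ε ≡ ε → ∀ ρ → ρ ε ≡ ε →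
           ∀ {n x p r Γ₂ Δ₂ Γ₃ Δ₃} → G3 false n Γ₂ Δ₂ → σ y ≡ x →
           ⟨ p , x ▷ r ⟩ ∈ Γ₃ → Der false Γ₃ ((p ⦂ B) ∷ Δ₃) → Der false ((r ⦂ C) ∷ Γ₃) Δ₃ →
           CutInto σ ρ x (B −∗ C) Γ₁ Δ₁ Γ₂ Δ₂ Γ₃ Δ₃
  cut-−∗ B C {Γ₁} {Δ₁} {y} (−∗-principal a b a≢b (a∉Γ₁ , a∉Δ₁) (b∉Γ₁ , b∉Δ₁) y∈ f) σ σε ρ ρε {p = p} {r}
      d₂ refl rel∈ r₁ r₂ s₁ s₂ s₃ s₄ =
    cut-admissible C
      (cut-admissible B (weakenᴰ r₁ ⊆-refl (∷⁺ʳ _ ⊆-wk))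
        (f (update (update σ b r) a p) σε ρ ρε d₂
          (∈-∷⁺ʳ (there rel∈) (∷⁺ʳ _ s₁)
            ⊚ ⊆-reflexive (−∗R-eigenˡ σ a b p r a≢b y B Γ₁ a∉Γ₁ b∉Γ₁ (∉⇒≢ a∉Δ₁ y∈) (∉⇒≢ b∉Δ₁ y∈)))
          (⊆-under s₂ ⊚ ⊆-reflexive (−∗R-eigenʳ σ a b p r a≢b C Δ₁ a∉Δ₁ b∉Δ₁))
          (∷⁺ʳ _ ⊆-wk ⊚ s₃) (⊆-wk ⊚ s₄)))
      r₂

G3-cut-elim : G3 true n Γ Δ → Der false Γ Δ
G3-cut-elim (gid m₁ m₂) = 1 , gid m₁ m₂
G3-cut-elim (g⊥L m) = 1 , g⊥L m
G3-cut-elim (g⊤R m) = 1 , g⊤R m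
G3-cut-elim (g⊤*R m) = 1 , g⊤*R m
G3-cut-elim (gcut {B = B} _ d₁ d₂) = cut-admissible B (G3-cut-elim d₁) (G3-cut-elim d₂)
G3-cut-elim (g⊤*L m w≢ε d) = rule₁ (g⊤*L m w≢ε) (G3-cut-elim d)
G3-cut-elim (g∧L m d) = rule₁ (g∧L m) (G3-cut-elim d)
G3-cut-elim (g∧R m d₁ d₂) = rule₂ (g∧R m) (G3-cut-elim d₁) (G3-cut-elim d₂)
G3-cut-elim (g⇒L m d₁ d₂) = rule₂ (g⇒L m) (G3-cut-elim d₁) (G3-cut-elim d₂)
G3-cut-elim (g⇒R m d) = rule₁ (g⇒R m) (G3-cut-elim d)
G3-cut-elim (g∗L m a≢b fa fb d) = rule₁ (g∗L m a≢b fa fb) (G3-cut-elim d)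
G3-cut-elim (g−∗R m a≢b fa fb d) = rule₁ (g−∗R m a≢b fa fb) (G3-cut-elim d)
G3-cut-elim (g∗R m₁ m₂ d₁ d₂) = rule₂ (g∗R m₁ m₂) (G3-cut-elim d₁) (G3-cut-elim d₂)
G3-cut-elim (g−∗L m₁ m₂ d₁ d₂) = rule₂ (g−∗L m₁ m₂) (G3-cut-elim d₁) (G3-cut-elim d₂)
G3-cut-elim (gE m d) = rule₁ (gE m) (G3-cut-elim d)
G3-cut-elim (gU d) = rule₁ gU (G3-cut-elim d)
G3-cut-elim (gA m₁ m₂ fa d) = rule₁ (gA m₁ m₂ fa) (G3-cut-elim d)
G3-cut-elim (gAC m fa d) = rule₁ (gAC m fa) (G3-cut-elim d)
G3-cut-elim (gEq m w≢ε d) = rule₁ (gEq m w≢ε) (G3-cut-elim d)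

-- Translations between LS and G3

⊆-rotate₃ : ∀ {A : Set} {a b c : A} {xs} → a ∷ b ∷ c ∷ xs ⊆ c ∷ a ∷ b ∷ xs
⊆-rotate₃ (here refl) = there (here refl)
⊆-rotate₃ (there (here refl)) = there (there (here refl))
⊆-rotate₃ (there (there (here refl))) = here refl
⊆-rotate₃ (there (there (there q))) = there (there (there q))

Eq₁-premise : ∀ w' w Γ → ¬ (w ≡ ε) →
             ⟨ ε , w' ▷ w' ⟩ ∷ (Γ [ w' / w ]ˡ) ≡ mapLI (substL w' w) ⟨ ε , w ▷ w' ⟩ ∷ substˡ w' w Γ
Eq₁-premise w' w Γ w≢ε =
  cong₂ _∷_ (sym (⟨⟩-cong (substL-ε w' w w≢ε) (substL-hit w' w) (substL-self w' w))) ([/]ˡ≡substˡ w' w Γ)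

Eq₂-premise : ∀ w' w Γ → ¬ (w ≡ ε) →
              ⟨ ε , w' ▷ w' ⟩ ∷ (Γ [ w' / w ]ˡ) ≡ mapLI (substL w' w) ⟨ ε , w' ▷ w ⟩ ∷ substˡ w' w Γ
Eq₂-premise w' w Γ w≢ε =
  cong₂ _∷_ (sym (⟨⟩-cong (substL-ε w' w w≢ε) (substL-self w' w) (substL-hit w' w))) ([/]ˡ≡substˡ w' w Γ)

LS⇒G3 : LS true Γ Δ → Der true Γ Δ
LS⇒G3 (perm p q d) = weakenᴰ (LS⇒G3 d) (⊆-reflexive-↭ p) (⊆-reflexive-↭ q)
LS⇒G3 id = 1 , gid (here refl) (here refl)
LS⇒G3 ⊥L = 1 , g⊥L (here refl)
LS⇒G3 ⊤R = 1 , g⊤R (here refl)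
LS⇒G3 ⊤*R = 1 , g⊤*R (here refl)
LS⇒G3 (cut {Γ = Γ} {Γ'} {Δ} {Δ'} _ d₁ d₂) =
  rule₂ (gcut refl) (weakenᴰ (LS⇒G3 d₁) (xs⊆xs++ys Γ Γ') (∷⁺ʳ _ (xs⊆xs++ys Δ Δ')))
                    (weakenᴰ (LS⇒G3 d₂) (∷⁺ʳ _ (xs⊆ys++xs Γ' Γ)) (xs⊆ys++xs Δ' Δ))
LS⇒G3 {Δ = Δ} (⊤*L {Γ = Γ} {w = w} w≢ε d) =
  rule₁ (g⊤*L (here refl) w≢ε)
    (weakenᴰ (LS⇒G3 d) (⊆-wk ⊚ ⊆-reflexive ([/]ˡ≡substˡ ε w Γ)) (⊆-reflexive ([/]ʳ≡substʳ ε w Δ)))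
LS⇒G3 (∧L d) = rule₁ (g∧L (here refl)) (weakenᴰ (LS⇒G3 d) (∷⁺ʳ _ (∷⁺ʳ _ ⊆-wk)) ⊆-refl)
LS⇒G3 (∧R d₁ d₂) =
  rule₂ (g∧R (here refl)) (weakenᴰ (LS⇒G3 d₁) ⊆-refl (∷⁺ʳ _ ⊆-wk)) (weakenᴰ (LS⇒G3 d₂) ⊆-refl (∷⁺ʳ _ ⊆-wk))
LS⇒G3 (⇒L d₁ d₂) =
  rule₂ (g⇒L (here refl)) (weakenᴰ (LS⇒G3 d₁) ⊆-wk ⊆-refl) (weakenᴰ (LS⇒G3 d₂) (∷⁺ʳ _ ⊆-wk) ⊆-refl)
LS⇒G3 (⇒R d) = rule₁ (g⇒R (here refl)) (weakenᴰ (LS⇒G3 d) ⊆-refl (∷⁺ʳ _ ⊆-wk))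
LS⇒G3 (∗L a≢b fa fb d) = rule₁ (g∗L (here refl) a≢b fa fb) (weakenᴰ (LS⇒G3 d) (∷⁺ʳ _ (∷⁺ʳ _ (∷⁺ʳ _ ⊆-wk))) ⊆-refl)
LS⇒G3 (−∗R a≢b fa fb d) = rule₁ (g−∗R (here refl) a≢b fa fb) (weakenᴰ (LS⇒G3 d) ⊆-refl (∷⁺ʳ _ ⊆-wk))
LS⇒G3 (∗R d₁ d₂) = rule₂ (g∗R (here refl) (here refl)) (LS⇒G3 d₁) (LS⇒G3 d₂)
LS⇒G3 (−∗L d₁ d₂) = rule₂ (g−∗L (here refl) (there (here refl))) (LS⇒G3 d₁) (weakenᴰ (LS⇒G3 d₂) ⊆-rotate₃ ⊆-refl)
LS⇒G3 (E d) = rule₁ (gE (here refl)) (LS⇒G3 d)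
LS⇒G3 (U d) = rule₁ gU (LS⇒G3 d)
LS⇒G3 (A fa d) = rule₁ (gA (here refl) (there (here refl)) fa) (LS⇒G3 d)
LS⇒G3 (AC fa d) = rule₁ (gAC (here refl) fa) (LS⇒G3 d)
LS⇒G3 {Δ = Δ} (Eq₁ {Γ = Γ} {w = w} {w' = w'} w≢ε d) =
  rule₁ (gEq (inj₁ (here refl)) w≢ε)
    (weakenᴰ (LS⇒G3 d) (⊆-reflexive (Eq₁-premise w' w Γ w≢ε)) (⊆-reflexive ([/]ʳ≡substʳ w' w Δ)))
LS⇒G3 {Δ = Δ} (Eq₂ {Γ = Γ} {w = w} {w' = w'} w≢ε d) =
  rule₁ (gEq (inj₂ (here refl)) w≢ε)
    (weakenᴰ (LS⇒G3 d) (⊆-reflexive (Eq₂-premise w' w Γ w≢ε)) (⊆-reflexive ([/]ʳ≡substʳ w' w Δ)))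

∈⇒↭∷ : ∀ {A : Set} {e : A} {xs} → e ∈ xs → Σ (List A) λ ys → xs ↭ e ∷ ys
∈⇒↭∷ {e = e} m with ∈-∃++ m
... | ys , zs , refl = ys ++ zs , shift e ys zs

∈²⇒↭∷∷ : ∀ {A : Set} {e f : A} {xs} → e ∈ xs → f ∈ xs → ¬ (f ≡ e) → Σ (List A) λ ys → xs ↭ e ∷ f ∷ ys
∈²⇒↭∷∷ {e = e} m₁ m₂ f≢e with ∈⇒↭∷ m₁
... | ys , p with ∈-resp-↭ p m₂
...   | here f≡e = ⊥-elim (f≢e f≡e)
...   | there q with ∈⇒↭∷ q
...     | zs , p' = zs , ↭-trans p (↭-prep e p')

focusL : ∀ {e} → e ∈ Γ → (∀ {Γ₀} → Γ ↭ e ∷ Γ₀ → LS c (e ∷ Γ₀) Δ) → LS c Γ Δ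
focusL m k with ∈⇒↭∷ m
... | _ , p = perm (↭-sym p) ↭-refl (k p)

focusL₂ : ∀ {e f} → e ∈ Γ → f ∈ Γ → ¬ (f ≡ e) → (∀ {Γ₀} → Γ ↭ e ∷ f ∷ Γ₀ → LS c (e ∷ f ∷ Γ₀) Δ) → LS c Γ Δ
focusL₂ m₁ m₂ f≢e k with ∈²⇒↭∷∷ m₁ m₂ f≢e
... | _ , p = perm (↭-sym p) ↭-refl (k p)

focusR : ∀ {e} → e ∈ Δ → (∀ {Δ₀} → Δ ↭ e ∷ Δ₀ → LS c Γ (e ∷ Δ₀)) → LS c Γ Δ
focusR m k with ∈⇒↭∷ m
... | _ , q = perm ↭-refl (↭-sym q) (k q)

unfocusL : Γ ↭ Γ' → LS c Γ Δ → LS c Γ' Δ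
unfocusL p = perm p ↭-refl

⟨⟩-injective : ∀ {a a' b b' c c'} → ⟨ a , b ▷ c ⟩ ≡ ⟨ a' , b' ▷ c' ⟩ → (a ≡ a') × (b ≡ b') × (c ≡ c')
⟨⟩-injective refl = refl , refl , refl

⟨⟩-≟ : ∀ a b c a' b' c' → Dec (⟨ a , b ▷ c ⟩ ≡ ⟨ a' , b' ▷ c' ⟩)
⟨⟩-≟ a b c a' b' c' with a ≟ℓ a' | b ≟ℓ b' | c ≟ℓ c'
... | yes refl | yes refl | yes refl = yes refl
... | no a≢a' | _ | _ = no (λ e → a≢a' (proj₁ (⟨⟩-injective e)))
... | yes _ | no b≢b' | _ = no (λ e → b≢b' (proj₁ (proj₂ (⟨⟩-injective e))))
... | yes _ | yes _ | no c≢c' = no (λ e → c≢c' (proj₂ (proj₂ (⟨⟩-injective e))))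

-- Each rule is applied to its principal item moved to the front; G3 kept that
-- item in the premises, and where LS consumes it an inversion removes it.
G3⇒LS : ∀ n {Γ Δ} → G3 false n Γ Δ → LS false Γ Δ
G3⇒LS zero ()
G3⇒LS (suc n) (gid m₁ m₂) = focusL m₁ λ _ → focusR m₂ λ _ → id
G3⇒LS (suc n) (g⊥L m) = focusL m λ _ → ⊥L
G3⇒LS (suc n) (g⊤R m) = focusR m λ _ → ⊤R
G3⇒LS (suc n) (g⊤*R m) = focusR m λ _ → ⊤*R
G3⇒LS (suc n) (gcut () _ _)
G3⇒LS (suc n) {Δ = Δ} (g⊤*L {w = w} m w≢ε d) = focusL m λ {Γ₀} p →
  ⊤*L w≢ε (perm (↭-reflexive (sym ([/]ˡ≡substˡ ε w Γ₀))) (↭-reflexive (sym ([/]ʳ≡substʳ ε w Δ)))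
    (G3⇒LS n (simulate ⊤*L-inversion n d
      (⊆-reflexive (cong (λ l → (l ⦂ ⊤*) ∷ substˡ ε w Γ₀) (substL-hit ε w)) ⊚ ⊆-mapL (substL ε w) (⊆-reflexive-↭ p) , ⊆-refl))))
G3⇒LS (suc n) (g∧L {w = w} {B = B} {C = C} m d) = focusL m λ p →
  ∧L (G3⇒LS n (simulate (∧L-inversion B C) n d (w , ⊆-under (⊆-under (⊆-reflexive-↭ p)) , ⊆-refl , here refl , there (here refl))))
G3⇒LS (suc n) (g∧R {w = w} {B = B} {C = C} m d₁ d₂) = focusR m λ q →
  ∧R (G3⇒LS n (simulate (∧R-inversion B C) n d₁ (w , ⊆-refl , ⊆-under (⊆-reflexive-↭ q) , inj₁ (here refl))))
     (G3⇒LS n (simulate (∧R-inversion B C) n d₂ (w , ⊆-refl , ⊆-under (⊆-reflexive-↭ q) , inj₂ (here refl))))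
G3⇒LS (suc n) (g⇒L {w = w} {B = B} {C = C} m d₁ d₂) = focusL m λ p →
  ⇒L (G3⇒LS n (simulate (⇒L-inversion B C) n d₁ (w , ⊆-reflexive-↭ p , ⊆-refl , inj₁ (here refl))))
     (G3⇒LS n (simulate (⇒L-inversion B C) n d₂ (w , ⊆-under (⊆-reflexive-↭ p) , ⊆-refl , inj₂ (here refl))))
G3⇒LS (suc n) (g⇒R {w = w} {B = B} {C = C} m d) = focusR m λ q →
  ⇒R (G3⇒LS n (simulate (⇒R-inversion B C) n d (w , ⊆-refl , ⊆-under (⊆-reflexive-↭ q) , here refl , here refl)))
G3⇒LS (suc n) {Δ = Δ} (g∗L {z = z} {B = B} {C = C} {a = a} {b = b} m a≢b fa fb d) = focusL m λ p →
  ∗L a≢b (FreshIn-↭ˡ Δ (↭-sym p) fa) (FreshIn-↭ˡ Δ (↭-sym p) fb)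
    (G3⇒LS n (simulate (∗L-inversion B C) n d ((z , var a , var b) , ⊆-under (⊆-under (⊆-under (⊆-reflexive-↭ p))) ,
                 ⊆-refl , here refl , there (here refl) , there (there (here refl)))))
G3⇒LS (suc n) {Γ = Γ} (g−∗R {y = y} {B = B} {C = C} {a = a} {b = b} m a≢b fa fb d) = focusR m λ q →
  −∗R a≢b (FreshIn-↭ʳ Γ (↭-sym q) fa) (FreshIn-↭ʳ Γ (↭-sym q) fb)
    (G3⇒LS n (simulate (−∗R-inversion B C) n d ((y , var a , var b) , ⊆-refl , ⊆-under (⊆-reflexive-↭ q) ,
                 here refl , there (here refl) , here refl)))
G3⇒LS (suc n) (g∗R m₁ m₂ d₁ d₂) = focusL m₁ λ p → focusR m₂ λ q →
  ∗R (perm p (↭-prep _ q) (G3⇒LS n d₁)) (perm p (↭-prep _ q) (G3⇒LS n d₂))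
G3⇒LS (suc n) (g−∗L m₁ m₂ d₁ d₂) = focusL₂ m₁ m₂ (λ ()) λ p →
  −∗L (unfocusL p (G3⇒LS n d₁))
      (unfocusL (↭-trans (↭-prep _ p) (↭-trans (↭-swap _ _ ↭-refl) (↭-prep _ (↭-swap _ _ ↭-refl)))) (G3⇒LS n d₂))
G3⇒LS (suc n) (gE m d) = focusL m λ p → E (unfocusL (↭-prep _ p) (G3⇒LS n d))
G3⇒LS (suc n) (gU d) = U (G3⇒LS n d)
G3⇒LS (suc n) {Δ = Δ} (gA {x = x} {y = y} {z = z} {u = u} {v = v} m₁ m₂ fa d) with ⟨⟩-≟ u v x x y z
... | yes refl = focusL m₁ λ p → AC (FreshIn-↭ˡ Δ (↭-sym p) fa) (unfocusL (↭-prep _ (↭-prep _ p)) (G3⇒LS n d))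
... | no distinct = focusL₂ m₁ m₂ distinct λ p →
  A (FreshIn-↭ˡ Δ (↭-sym p) fa) (unfocusL (↭-prep _ (↭-prep _ p)) (G3⇒LS n d))
G3⇒LS (suc n) {Δ = Δ} (gAC m fa d) = focusL m λ p →
  AC (FreshIn-↭ˡ Δ (↭-sym p) fa) (unfocusL (↭-prep _ (↭-prep _ p)) (G3⇒LS n d))
G3⇒LS (suc n) {Δ = Δ} (gEq {w = w} {w' = w'} (inj₁ m) w≢ε d) = focusL m λ {Γ₀} p →
  Eq₁ w≢ε (perm (↭-trans (↭-map⁺ (mapLI (substL w' w)) p) (↭-reflexive (sym (Eq₁-premise w' w Γ₀ w≢ε))))
               (↭-reflexive (sym ([/]ʳ≡substʳ w' w Δ))) (G3⇒LS n d))
G3⇒LS (suc n) {Δ = Δ} (gEq {w = w} {w' = w'} (inj₂ m) w≢ε d) = focusL m λ {Γ₀} p →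
  Eq₂ w≢ε (perm (↭-trans (↭-map⁺ (mapLI (substL w' w)) p) (↭-reflexive (sym (Eq₂-premise w' w Γ₀ w≢ε))))
               (↭-reflexive (sym ([/]ʳ≡substʳ w' w Δ))) (G3⇒LS n d))

theorem3 : (Γ : List LItem) (Δ : List RItem) → Derivable Γ Δ → CutFreeDerivable Γ Δ
theorem3 Γ Δ d =
  let (_ , g) = LS⇒G3 d
      (m , g') = G3-cut-elim g
  in G3⇒LS m g'
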